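{- Let $n\ge2$ and let $k$ be an even integer with $2\le k\le 2n-2$. Let $\mathcal M_n(k)$ be the graph whose vertex set $MO_n(k)$ is the set of components of $O_n([k])$ that are isomorphic to some middle levels graph $B_m$ ($m\ge1$), in which two distinct such components $C,C'$ are adjacent iff $C'=(a,k)\,C$ for some $a\in[k-1]$. Then $\mathcal M_n(k)\cong O_{k/2}$.
   Context: $[r]=\{1,\dots,r\}$. The odd graph $O_n$ has as vertices the $(n-1)$-element subsets of $[2n-1]$, with $u\sim v$ iff $u\cap v=\emptyset$; the edge $uv$ receives the colour equal to the unique element of $[2n-1]\setminus(u\cup v)$. $O_n([k])$ is the spanning subgraph of $O_n$ obtained by deleting every edge whose colour lies in $[k]$. The middle levels graph $B_m$ has as vertices the subsets of $[2m-1]$ of size $m-1$ or $m$, with $u\sim v$ iff one has size $m-1$, the other size $m$, and the smaller is contained in the larger. A component is a maximal connected subgraph. A permutation $\sigma$ of $[2n-1]$ acts on vertices of $O_n$ by $v\mapsto\sigma(v)$ and on subgraphs by applying this to all vertices; $(a,k)$ denotes the transposition of $a$ and $k$. -}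

module Defs where

open import Data.Nat using (ℕ; zero; suc; _+_; _*_; _∸_; _≤_; _<_)
open import Data.Fin using (Fin; toℕ)
open import Data.Fin.Subset using (Subset; _∈_; _∉_; _⊆_; _∩_; ∣_∣; Empty)
open import Data.Fin.Permutation.Components using (transpose)
open import Data.Vec using (tabulate; lookup)
open import Data.Product using (Σ; ∃; _×_; _,_; proj₁)
open import Data.Sum using (_⊎_)
open import Relation.Nullary using (¬_)
open import Relation.Binary.PropositionalEquality using (_≡_; _≢_)
open import Relation.Binary.Construct.Closure.ReflexiveTransitive using (Star)

-- Graphs with a vertex equality (setoid-style), and isomorphism.
-- Vertex sets that are quotients (e.g. sets of components) are
-- represented by representatives together with the equivalence _≈_.

record Graph : Set₁ where
  field
    V   : Set
    _≈_ : V → V → Set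
    _~_ : V → V → Set

open Graph

record _≅_ (G H : Graph) : Set where
  field
    to      : V G → V H
    to-cong : ∀ {x y} → _≈_ G x y → _≈_ H (to x) (to y)
    to-inj  : ∀ {x y} → _≈_ H (to x) (to y) → _≈_ G x y
    to-surj : ∀ y → Σ (V G) (λ x → _≈_ H (to x) y)
    adj⇒    : ∀ {x y} → _~_ G x y → _~_ H (to x) (to y)
    adj⇐    : ∀ {x y} → _~_ H (to x) (to y) → _~_ G x y

-- Ground set [2n-1], represented by Fin (2n-1); the element i+1 of
-- [2n-1] is represented by the index i : Fin (2n-1).

N : ℕ → ℕ
N n = 2 * n ∸ 1

OVert : ℕ → Set
OVert n = Σ (Subset (N n)) (λ s → ∣ s ∣ ≡ n ∸ 1)

-- Adjacency in O_n: disjoint (and distinct; this only matters for n = 1,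
-- where O_1 is the one-vertex graph without loops).
OAdj : (n : ℕ) → OVert n → OVert n → Set
OAdj n u v = Empty (proj₁ u ∩ proj₁ v) × proj₁ u ≢ proj₁ v

O : ℕ → Graph
O n = record
  { V   = OVert n
  ; _≈_ = λ u v → proj₁ u ≡ proj₁ v
  ; _~_ = OAdj n
  }

-- Adjacency in O_n([k]): an edge uv of O_n whose colour (the unique
-- element of [2n-1] outside u ∪ v) does not lie in [k].  The element
-- with index c is toℕ c + 1, which lies in [k] iff toℕ c < k.
OkAdj : (n k : ℕ) → OVert n → OVert n → Set
OkAdj n k u v = OAdj n u v
  × (∀ (c : Fin (N n)) → c ∉ proj₁ u → c ∉ proj₁ v → k ≤ toℕ c)

Conn : (n k : ℕ) → OVert n → OVert n → Set
Conn n k = Star (OkAdj n k)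

Component : (n k : ℕ) → OVert n → Graph
Component n k v = record
  { V   = Σ (OVert n) (λ w → Conn n k v w)
  ; _≈_ = λ x y → proj₁ (proj₁ x) ≡ proj₁ (proj₁ y)
  ; _~_ = λ x y → OkAdj n k (proj₁ x) (proj₁ y)
  }

BVert : ℕ → Set
BVert m = Σ (Subset (N m)) (λ s → (∣ s ∣ ≡ m ∸ 1) ⊎ (∣ s ∣ ≡ m))

BAdj : (m : ℕ) → BVert m → BVert m → Set
BAdj m u v =
    (∣ proj₁ u ∣ ≡ m ∸ 1 × ∣ proj₁ v ∣ ≡ m × proj₁ u ⊆ proj₁ v)
  ⊎ (∣ proj₁ v ∣ ≡ m ∸ 1 × ∣ proj₁ u ∣ ≡ m × proj₁ v ⊆ proj₁ u)

B : ℕ → Graph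
B m = record
  { V   = BVert m
  ; _≈_ = λ u v → proj₁ u ≡ proj₁ v
  ; _~_ = BAdj m
  }

-- Action of the transposition (a,b) on a subset:  (a,b)(s) = { (a,b)(x) : x ∈ s }.
-- Since (a,b) is an involution, i ∈ (a,b)(s) iff (a,b)(i) ∈ s.
swapSet : ∀ {r} → Fin r → Fin r → Subset r → Subset r
swapSet a b s = tabulate (λ i → lookup s (transpose a b i))

IsMiddleComp : (n k : ℕ) → OVert n → Set
IsMiddleComp n k v = ∃ λ m → 1 ≤ m × (Component n k v ≅ B m)

MVert : ℕ → ℕ → Set
MVert n k = Σ (OVert n) (IsMiddleComp n k)

-- C' = (a,k) C, where C, C' are the components of u, v: equality of
-- vertex sets  { w : w ∈ C' } = { (a,k)(w') : w' ∈ C }.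
-- Here kk is the index of the element k, and a the index of an element of [k-1].
MAdj : (n k : ℕ) → MVert n k → MVert n k → Set
MAdj n k x y =
    ¬ Conn n k (proj₁ x) (proj₁ y)
  × ∃ λ (a : Fin (N n)) → ∃ λ (kk : Fin (N n)) →
      toℕ a < k ∸ 1 × toℕ kk ≡ k ∸ 1 ×
      (∀ (w : OVert n) →
          (Conn n k (proj₁ y) w →
             Σ (OVert n) (λ w' → Conn n k (proj₁ x) w' × swapSet a kk (proj₁ w') ≡ proj₁ w))
        × (Σ (OVert n) (λ w' → Conn n k (proj₁ x) w' × swapSet a kk (proj₁ w') ≡ proj₁ w) →
             Conn n k (proj₁ y) w))

M : ℕ → ℕ → Graph
M n k = record
  { V   = MVert n k
  ; _≈_ = λ x y → Conn n k (proj₁ x) (proj₁ y)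
  ; _~_ = MAdj n k
  }

module Submission where

-- Split the ground set as [k] ⊔ R with |R| = 2n - 1 - k. Two (n - 1)-sets are adjacent in O_n([k])
-- iff they are complementary on [k] and disjoint on R, so along a walk the trace on [k] alternates
-- between a set P and ∁P. If |P| = k/2, every vertex with trace P or ∁P is reachable (exchanging one
-- element of the R-part costs two steps), and w ↦ w ∩ R resp. R ∖ w maps the component isomorphically
-- onto B_m, m = n - k/2. If |P| ≠ k/2 the two sides have different degrees |R ∖ w|, whereas B_m is
-- m-regular, so no such component is middle. A middle component is thus determined by {P, ∁P}, i.e.
-- by the (k/2 - 1)-set of positions a ∈ [k - 1] whose membership agrees with that of k. The
-- transposition (a, k) of a disagreeing position turns this set into its complement minus a, so
-- adjacency in M_n(k) becomes disjointness in O_{k/2}.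

open import Defs
open import Axiom.UniquenessOfIdentityProofs using (module Decidable⇒UIP)
open import Data.Bool using (Bool; true; false; not)
open import Data.Bool.Properties using (not-involutive) renaming (_≟_ to _≟ᵇ_)
open import Data.Empty using (⊥; ⊥-elim)
open import Data.Fin using (Fin; zero; suc; toℕ; inject₁; fromℕ; fromℕ<; _↑ˡ_; _↑ʳ_)
open import Data.Fin.Permutation.Components using (transpose)
open import Data.Fin.Properties
  using (_≟_; injective⇒≤; inject₁-injective; fromℕ≢inject₁; ↑ˡ-injective; ↑ʳ-injective;
         toℕ-↑ˡ; toℕ-↑ʳ; toℕ<n; toℕ-inject₁; toℕ-fromℕ; toℕ-fromℕ<; toℕ-injective)
  renaming (suc-injective to Fin-suc-injective)
open import Data.Fin.Subset using (Subset; ∣_∣; ∁; _∩_; _⊆_; _∉_; Empty)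
open import Data.Fin.Subset.Properties using (∣p∣≤∣x∷p∣; ∣p∣≤n; x∈p∩q⁺; x∈p∩q⁻)
open import Data.Nat using (ℕ; zero; suc; _+_; _*_; _∸_; _≤_; _<_; _/_; z≤n; s≤s)
open import Data.Nat.DivMod using (m*n/n≡m)
open import Data.Nat.Divisibility using (_∣_; divides)
open import Data.Nat.Properties
  using (+-identityʳ; +-suc; +-comm; +-cancelʳ-≡; +-cancelˡ-≡; suc-injective; 1+n≢n; ≡-irrelevant;
         ≤-refl; ≤-reflexive; ≤-trans; ≤-antisym; m≤n⇒m≤1+n; m≤m+n; <⇒≱; ≮⇒≥; +-mono-<; m+[n∸m]≡n)
open import Data.Nat.Tactic.RingSolver using (solve-∀)
open import Data.Product using (Σ; ∃; ∃₂; _×_; _,_; proj₁; proj₂)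
open import Data.Sum using (_⊎_; inj₁; inj₂)
open import Data.Vec using (Vec; []; _∷_; lookup; tabulate; _++_; _[_]≔_; _∷ʳ_; take; drop)
open import Data.Vec.Properties
  using ([]=⇒lookup; lookup⇒[]=; tabulate∘lookup; tabulate-cong; lookup∘tabulate; take++drop≡id;
         ++-injectiveˡ; ++-injectiveʳ; lookup-++ˡ; lookup-++ʳ; lookup-map; lookup∘update; lookup∘update′)
open import Function using (_∘_)
open import Relation.Binary.Construct.Closure.ReflexiveTransitive using (Star; ε; _◅_; _◅◅_)
open import Relation.Binary.Definitions using (_Respectsʳ_)
open import Relation.Binary.PropositionalEquality
  using (_≡_; _≢_; refl; sym; trans; cong; cong₂; subst; subst₂; module ≡-Reasoning)
open import Relation.Binary.Structures using (IsEquivalence)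
open import Relation.Nullary using (¬_; Dec; yes; no)
open import Relation.Nullary.Decidable using (dec-true; dec-false)

private variable
  A : Set
  n : ℕ

true≢false : true ≢ false
true≢false ()

b≢not-b : ∀ b → b ≢ not b
b≢not-b true ()
b≢not-b false ()

≢true⇒≡false : ∀ {b} → b ≢ true → b ≡ false
≢true⇒≡false {false} _ = refl
≢true⇒≡false {true} b≢true = ⊥-elim (b≢true refl)

≢⇒≡not : ∀ {a b} → a ≢ b → a ≡ not b
≢⇒≡not {true} {true} a≢b = ⊥-elim (a≢b refl)
≢⇒≡not {true} {false} _ = refl
≢⇒≡not {false} {true} _ = refl
≢⇒≡not {false} {false} a≢b = ⊥-elim (a≢b refl)

exactly-one : ∀ {a b} → (a ≡ true → b ≡ true → ⊥) → (a ≡ false → b ≡ false → ⊥) → b ≡ not a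
exactly-one {true} {true} not-both _ = ⊥-elim (not-both refl refl)
exactly-one {true} {false} _ _ = refl
exactly-one {false} {true} _ _ = refl
exactly-one {false} {false} _ neither = ⊥-elim (neither refl refl)

≗-lookup⇒≡ : {xs ys : Vec A n} → (∀ i → lookup xs i ≡ lookup ys i) → xs ≡ ys
≗-lookup⇒≡ {xs = xs} {ys} eq =
  trans (sym (tabulate∘lookup xs)) (trans (tabulate-cong eq) (tabulate∘lookup ys))

data SplitView (k r : ℕ) : Fin (k + r) → Set where
  left  : ∀ i → SplitView k r (i ↑ˡ r)
  right : ∀ t → SplitView k r (k ↑ʳ t)

splitView : ∀ k {r} (c : Fin (k + r)) → SplitView k r c
splitView zero c = right c
splitView (suc k) zero = left zero
splitView (suc k) (suc c) with splitView k c
... | left i = left (suc i)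
... | right t = right t

lookup-take : ∀ k {r} (xs : Vec A (k + r)) i → lookup xs (i ↑ˡ r) ≡ lookup (take k xs) i
lookup-take k {r} xs i = begin
  lookup xs (i ↑ˡ r)                           ≡⟨ cong (λ ys → lookup ys (i ↑ˡ r)) (take++drop≡id k xs) ⟨
  lookup (take k xs ++ drop k xs) (i ↑ˡ r)     ≡⟨ lookup-++ˡ (take k xs) (drop k xs) i ⟩
  lookup (take k xs) i                         ∎
  where open ≡-Reasoning

lookup-drop : ∀ k {r} (xs : Vec A (k + r)) t → lookup xs (k ↑ʳ t) ≡ lookup (drop k xs) t
lookup-drop k xs t = begin
  lookup xs (k ↑ʳ t)                           ≡⟨ cong (λ ys → lookup ys (k ↑ʳ t)) (take++drop≡id k xs) ⟨
  lookup (take k xs ++ drop k xs) (k ↑ʳ t)     ≡⟨ lookup-++ʳ (take k xs) (drop k xs) t ⟩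
  lookup (drop k xs) t                         ∎
  where open ≡-Reasoning

take-++ : ∀ {k r} (xs : Vec A k) (ys : Vec A r) → take k (xs ++ ys) ≡ xs
take-++ {k = k} xs ys = ++-injectiveˡ (take k (xs ++ ys)) xs (take++drop≡id k (xs ++ ys))

drop-++ : ∀ {k r} (xs : Vec A k) (ys : Vec A r) → drop k (xs ++ ys) ≡ ys
drop-++ {k = k} xs ys = ++-injectiveʳ (take k (xs ++ ys)) xs (take++drop≡id k (xs ++ ys))

-- Subsets

-- Membership t ∈ p of p : Subset n is stated as lookup p t ≡ true throughout.

lookup-∁ : (p : Subset n) (t : Fin n) → lookup (∁ p) t ≡ not (lookup p t)
lookup-∁ p t = lookup-map t not p

∁-involutive : (p : Subset n) → ∁ (∁ p) ≡ p
∁-involutive p = ≗-lookup⇒≡ λ t →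
  trans (lookup-∁ (∁ p) t) (trans (cong not (lookup-∁ p t)) (not-involutive _))

p≢∁p : (p : Subset (suc n)) → p ≢ ∁ p
p≢∁p p p≡∁p = b≢not-b (lookup p zero) (trans (cong (λ q → lookup q zero) p≡∁p) (lookup-∁ p zero))

∁-injective : {p q : Subset n} → ∁ p ≡ ∁ q → p ≡ q
∁-injective {p = p} {q} eq = trans (sym (∁-involutive p)) (trans (cong ∁ eq) (∁-involutive q))

lookup≡false⇒∉ : (p : Subset n) {t : Fin n} → lookup p t ≡ false → t ∉ p
lookup≡false⇒∉ p t∉p t∈p = true≢false (trans (sym ([]=⇒lookup t∈p)) t∉p)

∉⇒lookup≡false : (p : Subset n) {t : Fin n} → t ∉ p → lookup p t ≡ false
∉⇒lookup≡false p {t} t∉p = ≢true⇒≡false (t∉p ∘ lookup⇒[]= t p)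

∈∁⇒∉ : (p : Subset n) (t : Fin n) → lookup (∁ p) t ≡ true → lookup p t ≡ false
∈∁⇒∉ p t t∈∁p = ≢true⇒≡false λ t∈p →
  true≢false (trans (sym t∈∁p) (trans (lookup-∁ p t) (cong not t∈p)))

∉⇒∈∁ : (p : Subset n) (t : Fin n) → lookup p t ≡ false → lookup (∁ p) t ≡ true
∉⇒∈∁ p t t∉p = trans (lookup-∁ p t) (cong not t∉p)

lookup-update : ∀ (xs : Vec A n) i x t → lookup (xs [ i ]≔ x) t ≡ x ⊎ (t ≢ i × lookup (xs [ i ]≔ x) t ≡ lookup xs t)
lookup-update xs i x t with t ≟ i
... | yes refl = inj₁ (lookup∘update t xs x)
... | no t≢i = inj₂ (t≢i , lookup∘update′ t≢i xs x)

∈-insert : (p : Subset n) (i t : Fin n) → lookup p t ≡ true → lookup (p [ i ]≔ true) t ≡ true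
∈-insert p i t t∈p with lookup-update p i true t
... | inj₁ eq = eq
... | inj₂ (_ , eq) = trans eq t∈p

∈-insert⁻ : (p : Subset n) (i t : Fin n) → lookup (p [ i ]≔ true) t ≡ true → t ≢ i → lookup p t ≡ true
∈-insert⁻ p i t t∈p+i t≢i = trans (sym (lookup∘update′ t≢i p true)) t∈p+i

∈-remove : (p : Subset n) (i t : Fin n) → lookup p t ≡ true → t ≢ i → lookup (p [ i ]≔ false) t ≡ true
∈-remove p i t t∈p t≢i = trans (lookup∘update′ t≢i p false) t∈p

∈-remove⁻ : (p : Subset n) (i t : Fin n) → lookup (p [ i ]≔ false) t ≡ true → lookup p t ≡ true
∈-remove⁻ p i t t∈p-i with lookup-update p i false t
... | inj₁ eq = ⊥-elim (true≢false (trans (sym t∈p-i) eq))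
... | inj₂ (_ , eq) = trans (sym eq) t∈p-i

insert-injective : (p : Subset n) (i j : Fin n) → lookup p i ≡ false → p [ i ]≔ true ≡ p [ j ]≔ true → i ≡ j
insert-injective p i j i∉p eq with i ≟ j
... | yes i≡j = i≡j
... | no i≢j = ⊥-elim (true≢false (trans (sym i∈p) i∉p))
  where
  i∈p : lookup p i ≡ true
  i∈p = ∈-insert⁻ p j i (trans (cong (λ q → lookup q i) (sym eq)) (lookup∘update i p true)) i≢j

remove-injective : (p : Subset n) (i j : Fin n) → lookup p i ≡ true → p [ i ]≔ false ≡ p [ j ]≔ false → i ≡ j
remove-injective p i j i∈p eq with i ≟ j
... | yes i≡j = i≡j
... | no i≢j = ⊥-elim (true≢false (trans (sym i∈p-j) (trans (cong (λ q → lookup q i) (sym eq)) (lookup∘update i p false))))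
  where
  i∈p-j : lookup (p [ j ]≔ false) i ≡ true
  i∈p-j = ∈-remove p j i i∈p i≢j

∣++∣ : ∀ {k r} (p : Subset k) (q : Subset r) → ∣ p ++ q ∣ ≡ ∣ p ∣ + ∣ q ∣
∣++∣ [] q = refl
∣++∣ (true ∷ p) q = cong suc (∣++∣ p q)
∣++∣ (false ∷ p) q = ∣++∣ p q

∣p∣≡∣take∣+∣drop∣ : ∀ k {r} (p : Subset (k + r)) → ∣ p ∣ ≡ ∣ take k p ∣ + ∣ drop k p ∣
∣p∣≡∣take∣+∣drop∣ k p = trans (cong ∣_∣ (sym (take++drop≡id k p))) (∣++∣ (take k p) (drop k p))

∣∁p∣+∣p∣≡n : (p : Subset n) → ∣ ∁ p ∣ + ∣ p ∣ ≡ n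
∣∁p∣+∣p∣≡n [] = refl
∣∁p∣+∣p∣≡n (true ∷ p) = trans (+-suc _ _) (cong suc (∣∁p∣+∣p∣≡n p))
∣∁p∣+∣p∣≡n (false ∷ p) = cong suc (∣∁p∣+∣p∣≡n p)

∣p∣+c≡n⇒∣∁p∣≡c : ∀ (p : Subset n) c → ∣ p ∣ + c ≡ n → ∣ ∁ p ∣ ≡ c
∣p∣+c≡n⇒∣∁p∣≡c p c eq = +-cancelʳ-≡ ∣ p ∣ _ _ (trans (∣∁p∣+∣p∣≡n p) (trans (sym eq) (+-comm ∣ p ∣ c)))

∣∁p∣≡∣∁q∣⇒∣p∣≡∣q∣ : (p q : Subset n) → ∣ ∁ p ∣ ≡ ∣ ∁ q ∣ → ∣ p ∣ ≡ ∣ q ∣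
∣∁p∣≡∣∁q∣⇒∣p∣≡∣q∣ p q eq =
  +-cancelˡ-≡ ∣ ∁ p ∣ _ _ (trans (∣∁p∣+∣p∣≡n p) (trans (sym (∣∁p∣+∣p∣≡n q)) (cong (_+ ∣ q ∣) (sym eq))))

∣insert∣ : (p : Subset n) (i : Fin n) → lookup p i ≡ false → ∣ p [ i ]≔ true ∣ ≡ suc ∣ p ∣
∣insert∣ (false ∷ p) zero _ = refl
∣insert∣ (true ∷ p) (suc i) i∉p = cong suc (∣insert∣ p i i∉p)
∣insert∣ (false ∷ p) (suc i) i∉p = ∣insert∣ p i i∉p

∣remove∣ : (p : Subset n) (i : Fin n) → lookup p i ≡ true → suc ∣ p [ i ]≔ false ∣ ≡ ∣ p ∣
∣remove∣ (true ∷ p) zero _ = refl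
∣remove∣ (true ∷ p) (suc i) i∈p = cong suc (∣remove∣ p i i∈p)
∣remove∣ (false ∷ p) (suc i) i∈p = ∣remove∣ p i i∈p

_⊆ᵇ_ : Subset n → Subset n → Set
p ⊆ᵇ q = ∀ t → lookup p t ≡ true → lookup q t ≡ true

Disjoint : Subset n → Subset n → Set
Disjoint p q = ∀ t → lookup p t ≡ true → lookup q t ≡ false

Empty-∩⇒Disjoint : (p q : Subset n) → Empty (p ∩ q) → Disjoint p q
Empty-∩⇒Disjoint p q empty t t∈p =
  ≢true⇒≡false λ t∈q → empty (t , x∈p∩q⁺ (lookup⇒[]= t p t∈p , lookup⇒[]= t q t∈q))

Disjoint⇒Empty-∩ : (p q : Subset n) → Disjoint p q → Empty (p ∩ q)
Disjoint⇒Empty-∩ p q disj (t , t∈p∩q) with x∈p∩q⁻ p q t∈p∩q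
... | t∈p , t∈q = true≢false (trans (sym ([]=⇒lookup t∈q)) (disj t ([]=⇒lookup t∈p)))

⊆ᵇ⇒⊆ : ∀ {n} {p q : Subset n} → p ⊆ᵇ q → p ⊆ q
⊆ᵇ⇒⊆ {p = p} {q} p⊆q {t} t∈p = lookup⇒[]= t q (p⊆q t ([]=⇒lookup t∈p))

⊆⇒⊆ᵇ : ∀ {n} {p q : Subset n} → p ⊆ q → p ⊆ᵇ q
⊆⇒⊆ᵇ {p = p} p⊆q t t∈p = []=⇒lookup (p⊆q (lookup⇒[]= t p t∈p))

⊆ᵇ⇒Disjoint-∁ʳ : (p q : Subset n) → p ⊆ᵇ q → Disjoint p (∁ q)
⊆ᵇ⇒Disjoint-∁ʳ p q p⊆q t t∈p = trans (lookup-∁ q t) (cong not (p⊆q t t∈p))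

⊆ᵇ⇒Disjoint-∁ˡ : (p q : Subset n) → p ⊆ᵇ q → Disjoint (∁ q) p
⊆ᵇ⇒Disjoint-∁ˡ p q p⊆q t t∉q = ≢true⇒≡false λ t∈p → true≢false (trans (sym (p⊆q t t∈p)) (∈∁⇒∉ q t t∉q))

Disjoint-sym : (p q : Subset n) → Disjoint p q → Disjoint q p
Disjoint-sym p q disj t t∈q = ≢true⇒≡false λ t∈p → true≢false (trans (sym t∈q) (disj t t∈p))

Disjoint⇒⊆ᵇ∁ : (p q : Subset n) → Disjoint p q → p ⊆ᵇ ∁ q
Disjoint⇒⊆ᵇ∁ p q disj t t∈p = ∉⇒∈∁ q t (disj t t∈p)

⊆ᵇ∁⇒Disjoint : (p q : Subset n) → p ⊆ᵇ ∁ q → Disjoint p q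
⊆ᵇ∁⇒Disjoint p q p⊆∁q t t∈p = ∈∁⇒∉ q t (p⊆∁q t t∈p)

⊆ᵇ⇒∣≤∣ : (p q : Subset n) → p ⊆ᵇ q → ∣ p ∣ ≤ ∣ q ∣
⊆ᵇ⇒∣≤∣ [] [] _ = z≤n
⊆ᵇ⇒∣≤∣ (true ∷ p) (true ∷ q) p⊆q = s≤s (⊆ᵇ⇒∣≤∣ p q (λ t → p⊆q (suc t)))
⊆ᵇ⇒∣≤∣ (true ∷ p) (false ∷ q) p⊆q = ⊥-elim (true≢false (sym (p⊆q zero refl)))
⊆ᵇ⇒∣≤∣ (false ∷ p) (true ∷ q) p⊆q = m≤n⇒m≤1+n (⊆ᵇ⇒∣≤∣ p q (λ t → p⊆q (suc t)))
⊆ᵇ⇒∣≤∣ (false ∷ p) (false ∷ q) p⊆q = ⊆ᵇ⇒∣≤∣ p q (λ t → p⊆q (suc t))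

⊆ᵇ∧∣q∣≤∣p∣⇒≡ : (p q : Subset n) → p ⊆ᵇ q → ∣ q ∣ ≤ ∣ p ∣ → p ≡ q
⊆ᵇ∧∣q∣≤∣p∣⇒≡ [] [] _ _ = refl
⊆ᵇ∧∣q∣≤∣p∣⇒≡ (true ∷ p) (true ∷ q) p⊆q (s≤s ≤) = cong (true ∷_) (⊆ᵇ∧∣q∣≤∣p∣⇒≡ p q (λ t → p⊆q (suc t)) ≤)
⊆ᵇ∧∣q∣≤∣p∣⇒≡ (true ∷ p) (false ∷ q) p⊆q _ = ⊥-elim (true≢false (sym (p⊆q zero refl)))
⊆ᵇ∧∣q∣≤∣p∣⇒≡ (false ∷ p) (true ∷ q) p⊆q ≤ = ⊥-elim (<⇒≱ (s≤s (⊆ᵇ⇒∣≤∣ p q (λ t → p⊆q (suc t)))) ≤)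
⊆ᵇ∧∣q∣≤∣p∣⇒≡ (false ∷ p) (false ∷ q) p⊆q ≤ = cong (false ∷_) (⊆ᵇ∧∣q∣≤∣p∣⇒≡ p q (λ t → p⊆q (suc t)) ≤)

Disjoint-suc : ∀ {x y} (p q : Subset n) → Disjoint (x ∷ p) (y ∷ q) → Disjoint p q
Disjoint-suc p q disj t = disj (suc t)

∣p∣+∣q∣≤n : (p q : Subset n) → Disjoint p q → ∣ p ∣ + ∣ q ∣ ≤ n
∣p∣+∣q∣≤n [] [] _ = z≤n
∣p∣+∣q∣≤n (true ∷ p) (true ∷ q) disj = ⊥-elim (true≢false (disj zero refl))
∣p∣+∣q∣≤n (true ∷ p) (false ∷ q) disj = s≤s (∣p∣+∣q∣≤n p q (Disjoint-suc p q disj))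
∣p∣+∣q∣≤n {suc n} (false ∷ p) (true ∷ q) disj =
  subst (_≤ suc n) (sym (+-suc ∣ p ∣ ∣ q ∣)) (s≤s (∣p∣+∣q∣≤n p q (Disjoint-suc p q disj)))
∣p∣+∣q∣≤n (false ∷ p) (false ∷ q) disj = m≤n⇒m≤1+n (∣p∣+∣q∣≤n p q (Disjoint-suc p q disj))

Covering : Subset n → Subset n → Set
Covering p q = ∀ t → lookup p t ≡ true ⊎ lookup q t ≡ true

∣p∣+∣q∣≡n : (p q : Subset n) → Disjoint p q → Covering p q → ∣ p ∣ + ∣ q ∣ ≡ n
∣p∣+∣q∣≡n [] [] _ _ = refl
∣p∣+∣q∣≡n (true ∷ p) (true ∷ q) disj _ = ⊥-elim (true≢false (disj zero refl))
∣p∣+∣q∣≡n (true ∷ p) (false ∷ q) disj cov = cong suc (∣p∣+∣q∣≡n p q (Disjoint-suc p q disj) (λ t → cov (suc t)))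
∣p∣+∣q∣≡n (false ∷ p) (true ∷ q) disj cov =
  trans (+-suc _ _) (cong suc (∣p∣+∣q∣≡n p q (Disjoint-suc p q disj) (λ t → cov (suc t))))
∣p∣+∣q∣≡n (false ∷ p) (false ∷ q) _ cov with cov zero
... | inj₁ ()
... | inj₂ ()

commonHole⊎Covering : (p q : Subset n) → (∃ λ t → lookup p t ≡ false × lookup q t ≡ false) ⊎ Covering p q
commonHole⊎Covering [] [] = inj₂ (λ ())
commonHole⊎Covering (false ∷ p) (false ∷ q) = inj₁ (zero , refl , refl)
commonHole⊎Covering (true ∷ p) (y ∷ q) with commonHole⊎Covering p q
... | inj₁ (t , hole) = inj₁ (suc t , hole)
... | inj₂ cov = inj₂ λ { zero → inj₁ refl ; (suc t) → cov t }
commonHole⊎Covering (false ∷ p) (true ∷ q) with commonHole⊎Covering p q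
... | inj₁ (t , hole) = inj₁ (suc t , hole)
... | inj₂ cov = inj₂ λ { zero → inj₂ refl ; (suc t) → cov t }

∣p∣<n⇒∃∉ : (p : Subset n) → ∣ p ∣ < n → ∃ λ t → lookup p t ≡ false
∣p∣<n⇒∃∉ (false ∷ p) _ = zero , refl
∣p∣<n⇒∃∉ (true ∷ p) (s≤s ∣p∣<n) with ∣p∣<n⇒∃∉ p ∣p∣<n
... | t , t∉p = suc t , t∉p

0<∣p∣⇒∃∈ : (p : Subset n) → 0 < ∣ p ∣ → ∃ λ t → lookup p t ≡ true
0<∣p∣⇒∃∈ (true ∷ p) _ = zero , refl
0<∣p∣⇒∃∈ (false ∷ p) 0<∣p∣ with 0<∣p∣⇒∃∈ p 0<∣p∣
... | t , t∈p = suc t , t∈p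

∣p∣<∣q∣⇒∃∈q∖p : (p q : Subset n) → ∣ p ∣ < ∣ q ∣ → ∃ λ t → lookup q t ≡ true × lookup p t ≡ false
∣p∣<∣q∣⇒∃∈q∖p (false ∷ p) (true ∷ q) _ = zero , refl , refl
∣p∣<∣q∣⇒∃∈q∖p (true ∷ p) (true ∷ q) (s≤s ∣p∣<∣q∣) with ∣p∣<∣q∣⇒∃∈q∖p p q ∣p∣<∣q∣
... | t , t∈q∖p = suc t , t∈q∖p
∣p∣<∣q∣⇒∃∈q∖p (x ∷ p) (false ∷ q) ∣p∣<∣q∣ with ∣p∣<∣q∣⇒∃∈q∖p p q (≤-trans (s≤s (∣p∣≤∣x∷p∣ x p)) ∣p∣<∣q∣)
... | t , t∈q∖p = suc t , t∈q∖p

∃-subset-of-size : ∀ n c → c ≤ n → Σ (Subset n) λ p → ∣ p ∣ ≡ c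
∃-subset-of-size zero zero _ = [] , refl
∃-subset-of-size (suc n) zero _ with ∃-subset-of-size n zero z≤n
... | p , ∣p∣≡0 = false ∷ p , ∣p∣≡0
∃-subset-of-size (suc n) (suc c) (s≤s c≤n) with ∃-subset-of-size n c c≤n
... | p , ∣p∣≡c = true ∷ p , cong suc ∣p∣≡c

2+∣p∣+∣q∣≤n : (p q : Subset n) (i j : Fin n) → Disjoint p q → i ≢ j →
  lookup p i ≡ false → lookup q i ≡ false → lookup p j ≡ false → lookup q j ≡ false →
  2 + (∣ p ∣ + ∣ q ∣) ≤ n
2+∣p∣+∣q∣≤n {n} p q i j disj i≢j i∉p i∉q j∉p j∉q =
  subst (_≤ n) ∣p+i+j∣+∣q∣ (∣p∣+∣q∣≤n (p [ i ]≔ true [ j ]≔ true) q disj′)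
  where
  j∉p+i : lookup (p [ i ]≔ true) j ≡ false
  j∉p+i = trans (lookup∘update′ (λ j≡i → i≢j (sym j≡i)) p true) j∉p
  ∣p+i+j∣+∣q∣ : ∣ p [ i ]≔ true [ j ]≔ true ∣ + ∣ q ∣ ≡ 2 + (∣ p ∣ + ∣ q ∣)
  ∣p+i+j∣+∣q∣ = cong (_+ ∣ q ∣) (trans (∣insert∣ (p [ i ]≔ true) j j∉p+i) (cong suc (∣insert∣ p i i∉p)))
  disj′ : Disjoint (p [ i ]≔ true [ j ]≔ true) q
  disj′ t t∈ with t ≟ j | t ≟ i
  ... | yes refl | _ = j∉q
  ... | no _ | yes refl = i∉q
  ... | no t≢j | no t≢i = disj t (∈-insert⁻ p i t (∈-insert⁻ (p [ i ]≔ true) j t t∈ t≢j) t≢i)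

select : (p : Subset n) → Fin ∣ p ∣ → Fin n
select (true ∷ p) zero = zero
select (true ∷ p) (suc i) = suc (select p i)
select (false ∷ p) i = suc (select p i)

select-∈ : (p : Subset n) (i : Fin ∣ p ∣) → lookup p (select p i) ≡ true
select-∈ (true ∷ p) zero = refl
select-∈ (true ∷ p) (suc i) = select-∈ p i
select-∈ (false ∷ p) i = select-∈ p i

select-injective : (p : Subset n) {i j : Fin ∣ p ∣} → select p i ≡ select p j → i ≡ j
select-injective (true ∷ p) {zero} {zero} _ = refl
select-injective (true ∷ p) {suc i} {suc j} eq = cong suc (select-injective p (Fin-suc-injective eq))
select-injective (false ∷ p) eq = select-injective p (Fin-suc-injective eq)

select-surjective : (p : Subset n) (t : Fin n) → lookup p t ≡ true → ∃ λ i → select p i ≡ t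
select-surjective (true ∷ p) zero _ = zero , refl
select-surjective (true ∷ p) (suc t) t∈p with select-surjective p t t∈p
... | i , eq = suc i , cong suc eq
select-surjective (false ∷ p) (suc t) t∈p with select-surjective p t t∈p
... | i , eq = i , cong suc eq

Exchange : Subset n → Subset n → Set
Exchange {n} p q = Σ (Fin n) λ j → lookup p j ≡ false × q ⊆ᵇ (p [ j ]≔ true) × ∣ q ∣ ≡ ∣ p ∣

∷-exchange : ∀ x {p q : Subset n} → Exchange p q → Exchange (x ∷ p) (x ∷ q)
∷-exchange x {p} {q} (j , j∉p , q⊆p+j , ∣q∣≡∣p∣) = suc j , j∉p , x∷q⊆ , ∣x∷q∣≡∣x∷p∣ x
  where
  x∷q⊆ : (x ∷ q) ⊆ᵇ ((x ∷ p) [ suc j ]≔ true)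
  x∷q⊆ zero t∈ = t∈
  x∷q⊆ (suc t) t∈ = q⊆p+j t t∈
  ∣x∷q∣≡∣x∷p∣ : ∀ x → ∣ x ∷ q ∣ ≡ ∣ x ∷ p ∣
  ∣x∷q∣≡∣x∷p∣ true = cong suc ∣q∣≡∣p∣
  ∣x∷q∣≡∣x∷p∣ false = ∣q∣≡∣p∣

∷-exchanges : ∀ x {p q : Subset n} → Star Exchange p q → Star Exchange (x ∷ p) (x ∷ q)
∷-exchanges x ε = ε
∷-exchanges x (e ◅ es) = ∷-exchange x e ◅ ∷-exchanges x es

exchanges : (p q : Subset n) → ∣ p ∣ ≡ ∣ q ∣ → Star Exchange p q
exchanges [] [] _ = ε
exchanges (true ∷ p) (true ∷ q) eq = ∷-exchanges true (exchanges p q (suc-injective eq))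
exchanges (false ∷ p) (false ∷ q) eq = ∷-exchanges false (exchanges p q eq)
exchanges (true ∷ p) (false ∷ q) eq with ∣p∣<n⇒∃∉ p (≤-trans (≤-reflexive eq) (∣p∣≤n q))
... | j , j∉p = first ◅ ∷-exchanges false (exchanges (p [ j ]≔ true) q (trans (∣insert∣ p j j∉p) eq))
  where
  first : Exchange (true ∷ p) (false ∷ (p [ j ]≔ true))
  first = suc j , j∉p , (λ { zero () ; (suc t) t∈ → t∈ }) , ∣insert∣ p j j∉p
exchanges (false ∷ p) (true ∷ q) eq with 0<∣p∣⇒∃∈ p (subst (0 <_) (sym eq) (s≤s z≤n))
... | j , j∈p = first ◅ ∷-exchanges true (exchanges (p [ j ]≔ false) q (suc-injective (trans (∣remove∣ p j j∈p) eq)))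
  where
  first : Exchange (false ∷ p) (true ∷ (p [ j ]≔ false))
  first = zero , refl , (λ { zero _ → refl ; (suc t) t∈ → ∈-remove⁻ p j t t∈ }) , ∣remove∣ p j j∈p

-- Transpositions

transpose-matchˡ : (a b : Fin n) → transpose a b a ≡ b
transpose-matchˡ a b rewrite dec-true (a ≟ a) refl = refl

transpose-matchʳ : (a b : Fin n) → transpose a b b ≡ a
transpose-matchʳ a b = by-cases (b ≟ a)
  where
  by-cases : Dec (b ≡ a) → transpose a b b ≡ a
  by-cases (yes b≡a) rewrite dec-true (b ≟ a) b≡a = b≡a
  by-cases (no b≢a) rewrite dec-false (b ≟ a) b≢a | dec-true (b ≟ b) refl = refl

transpose-other : (a b : Fin n) {i : Fin n} → i ≢ a → i ≢ b → transpose a b i ≡ i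
transpose-other a b {i} i≢a i≢b rewrite dec-false (i ≟ a) i≢a | dec-false (i ≟ b) i≢b = refl

data Transposed (a b : Fin n) : Fin n → Set where
  at-a : Transposed a b a
  at-b : Transposed a b b
  off  : ∀ {i} → i ≢ a → i ≢ b → Transposed a b i

transposed : (a b i : Fin n) → Transposed a b i
transposed a b i with i ≟ a | i ≟ b
... | yes refl | _ = at-a
... | no _ | yes refl = at-b
... | no i≢a | no i≢b = off i≢a i≢b

transpose-involutive : (a b i : Fin n) → transpose a b (transpose a b i) ≡ i
transpose-involutive a b i with transposed a b i
... | at-a = trans (cong (transpose a b) (transpose-matchˡ a b)) (transpose-matchʳ a b)
... | at-b = trans (cong (transpose a b) (transpose-matchʳ a b)) (transpose-matchˡ a b)
... | off i≢a i≢b = trans (cong (transpose a b) (transpose-other a b i≢a i≢b)) (transpose-other a b i≢a i≢b)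

lookup-swapSet : (a b : Fin n) (s : Subset n) (i : Fin n) → lookup (swapSet a b s) i ≡ lookup s (transpose a b i)
lookup-swapSet a b s i = lookup∘tabulate _ i

swapSet-involutive : (a b : Fin n) (s : Subset n) → swapSet a b (swapSet a b s) ≡ s
swapSet-involutive a b s = ≗-lookup⇒≡ λ i →
  trans (lookup-swapSet a b (swapSet a b s) i) (trans (lookup-swapSet a b s (transpose a b i)) (cong (lookup s) (transpose-involutive a b i)))

swapSet-id : (a b : Fin n) (s : Subset n) → lookup s a ≡ lookup s b → swapSet a b s ≡ s
swapSet-id a b s sa≡sb = ≗-lookup⇒≡ λ i → trans (lookup-swapSet a b s i) (fixed i)
  where
  fixed : ∀ i → lookup s (transpose a b i) ≡ lookup s i
  fixed i with transposed a b i
  ... | at-a = trans (cong (lookup s) (transpose-matchˡ a b)) (sym sa≡sb)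
  ... | at-b = trans (cong (lookup s) (transpose-matchʳ a b)) sa≡sb
  ... | off i≢a i≢b = cong (lookup s) (transpose-other a b i≢a i≢b)

swapSet≡update : (a b : Fin n) (s : Subset n) → a ≢ b → swapSet a b s ≡ s [ a ]≔ lookup s b [ b ]≔ lookup s a
swapSet≡update a b s a≢b = ≗-lookup⇒≡ λ i → trans (lookup-swapSet a b s i) (pointwise i)
  where
  pointwise : ∀ i → lookup s (transpose a b i) ≡ lookup (s [ a ]≔ lookup s b [ b ]≔ lookup s a) i
  pointwise i with transposed a b i
  ... | at-a = trans (cong (lookup s) (transpose-matchˡ a b))
                  (sym (trans (lookup∘update′ a≢b (s [ a ]≔ lookup s b) (lookup s a)) (lookup∘update a s (lookup s b))))
  ... | at-b = trans (cong (lookup s) (transpose-matchʳ a b)) (sym (lookup∘update b (s [ a ]≔ lookup s b) (lookup s a)))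
  ... | off i≢a i≢b = trans (cong (lookup s) (transpose-other a b i≢a i≢b))
                            (sym (trans (lookup∘update′ i≢b (s [ a ]≔ lookup s b) (lookup s a)) (lookup∘update′ i≢a s (lookup s b))))

∣swapSet∣ : (a b : Fin n) (s : Subset n) → ∣ swapSet a b s ∣ ≡ ∣ s ∣
∣swapSet∣ a b s with lookup s a in sa | lookup s b in sb
... | true | true = cong ∣_∣ (swapSet-id a b s (trans sa (sym sb)))
... | false | false = cong ∣_∣ (swapSet-id a b s (trans sa (sym sb)))
... | true | false = begin
  ∣ swapSet a b s ∣                        ≡⟨ cong ∣_∣ (swapSet≡update a b s a≢b) ⟩
  ∣ s [ a ]≔ lookup s b [ b ]≔ lookup s a ∣ ≡⟨ cong₂ (λ x y → ∣ s [ a ]≔ x [ b ]≔ y ∣) sb sa ⟩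
  ∣ s [ a ]≔ false [ b ]≔ true ∣           ≡⟨ ∣insert∣ (s [ a ]≔ false) b (trans (lookup∘update′ (λ b≡a → a≢b (sym b≡a)) s false) sb) ⟩
  suc ∣ s [ a ]≔ false ∣                   ≡⟨ ∣remove∣ s a sa ⟩
  ∣ s ∣                                    ∎
  where
  open ≡-Reasoning
  a≢b : a ≢ b
  a≢b refl = true≢false (trans (sym sa) sb)
... | false | true = begin
  ∣ swapSet a b s ∣                        ≡⟨ cong ∣_∣ (swapSet≡update a b s a≢b) ⟩
  ∣ s [ a ]≔ lookup s b [ b ]≔ lookup s a ∣ ≡⟨ cong₂ (λ x y → ∣ s [ a ]≔ x [ b ]≔ y ∣) sb sa ⟩
  ∣ s [ a ]≔ true [ b ]≔ false ∣           ≡⟨ suc-injective (trans (∣remove∣ (s [ a ]≔ true) b (trans (lookup∘update′ (λ b≡a → a≢b (sym b≡a)) s true) sb)) (∣insert∣ s a sa)) ⟩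
  ∣ s ∣                                    ∎
  where
  open ≡-Reasoning
  a≢b : a ≢ b
  a≢b refl = true≢false (trans (sym sb) sa)

_⇔ᵇ_ : Bool → Bool → Bool
true ⇔ᵇ b = b
false ⇔ᵇ b = not b

⇔ᵇ-trueʳ : ∀ a → a ⇔ᵇ true ≡ a
⇔ᵇ-trueʳ true = refl
⇔ᵇ-trueʳ false = refl

⇔ᵇ-falseʳ : ∀ a → a ⇔ᵇ false ≡ not a
⇔ᵇ-falseʳ true = refl
⇔ᵇ-falseʳ false = refl

⇔ᵇ-not : ∀ a b → not a ⇔ᵇ not b ≡ a ⇔ᵇ b
⇔ᵇ-not true b = not-involutive b
⇔ᵇ-not false b = refl

⇔ᵇ-notˡ : ∀ a b → not a ⇔ᵇ b ≡ not (a ⇔ᵇ b)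
⇔ᵇ-notˡ true b = refl
⇔ᵇ-notˡ false b = sym (not-involutive b)

⇔ᵇ-notʳ : ∀ a b → a ⇔ᵇ not b ≡ not (a ⇔ᵇ b)
⇔ᵇ-notʳ true b = refl
⇔ᵇ-notʳ false b = refl

⇔ᵇ-not-self : ∀ a → a ⇔ᵇ not a ≡ false
⇔ᵇ-not-self true = refl
⇔ᵇ-not-self false = refl

⇔ᵇ-cancelʳ : ∀ a a′ b → a ⇔ᵇ b ≡ a′ ⇔ᵇ b → a ≡ a′
⇔ᵇ-cancelʳ true true b _ = refl
⇔ᵇ-cancelʳ false false b _ = refl
⇔ᵇ-cancelʳ true false true ()
⇔ᵇ-cancelʳ true false false ()
⇔ᵇ-cancelʳ false true true ()
⇔ᵇ-cancelʳ false true false ()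

⇔ᵇ≡false⇒≡not : ∀ a b → a ⇔ᵇ b ≡ false → a ≡ not b
⇔ᵇ≡false⇒≡not true false _ = refl
⇔ᵇ≡false⇒≡not false true _ = refl

data InjectOrLast {n : ℕ} : Fin (suc n) → Set where
  inject : ∀ j → InjectOrLast (inject₁ j)
  last   : InjectOrLast (fromℕ n)

injectOrLast : (i : Fin (suc n)) → InjectOrLast i
injectOrLast {zero} zero = last
injectOrLast {suc n} zero = inject zero
injectOrLast {suc n} (suc i) with injectOrLast i
... | inject j = inject (suc j)
... | last = last

Aligned : Subset (suc n) → Subset n
Aligned {n} P = tabulate λ j → lookup P (inject₁ j) ⇔ᵇ lookup P (fromℕ n)

lookup-Aligned : (P : Subset (suc n)) (j : Fin n) → lookup (Aligned P) j ≡ lookup P (inject₁ j) ⇔ᵇ lookup P (fromℕ n)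
lookup-Aligned P j = lookup∘tabulate _ j

Aligned-∁ : (P : Subset (suc n)) → Aligned (∁ P) ≡ Aligned P
Aligned-∁ {n} P = tabulate-cong λ j → begin
  lookup (∁ P) (inject₁ j) ⇔ᵇ lookup (∁ P) (fromℕ n)     ≡⟨ cong₂ _⇔ᵇ_ (lookup-∁ P (inject₁ j)) (lookup-∁ P (fromℕ n)) ⟩
  not (lookup P (inject₁ j)) ⇔ᵇ not (lookup P (fromℕ n)) ≡⟨ ⇔ᵇ-not (lookup P (inject₁ j)) (lookup P (fromℕ n)) ⟩
  lookup P (inject₁ j) ⇔ᵇ lookup P (fromℕ n)             ∎
  where open ≡-Reasoning

Aligned-injective : (P Q : Subset (suc n)) → Aligned Q ≡ Aligned P → Q ≡ P ⊎ Q ≡ ∁ P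
Aligned-injective {n} P Q eq with lookup Q (fromℕ n) ≟ᵇ lookup P (fromℕ n)
... | yes same-last = inj₁ (≗-lookup⇒≡ λ i → same i (injectOrLast i))
  where
  same : ∀ (i : Fin (suc n)) → InjectOrLast i → lookup Q i ≡ lookup P i
  same _ (inject j) = ⇔ᵇ-cancelʳ _ _ _ (begin
    lookup Q (inject₁ j) ⇔ᵇ lookup P (fromℕ n) ≡⟨ cong (lookup Q (inject₁ j) ⇔ᵇ_) same-last ⟨
    lookup Q (inject₁ j) ⇔ᵇ lookup Q (fromℕ n) ≡⟨ lookup-Aligned Q j ⟨
    lookup (Aligned Q) j                       ≡⟨ cong (λ X → lookup X j) eq ⟩
    lookup (Aligned P) j                       ≡⟨ lookup-Aligned P j ⟩
    lookup P (inject₁ j) ⇔ᵇ lookup P (fromℕ n) ∎)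
    where open ≡-Reasoning
  same _ last = same-last
... | no other-last = inj₂ (≗-lookup⇒≡ λ i → trans (opposite i (injectOrLast i)) (sym (lookup-∁ P i)))
  where
  Qlast≡not : lookup Q (fromℕ n) ≡ not (lookup P (fromℕ n))
  Qlast≡not = ≢⇒≡not other-last
  opposite : ∀ (i : Fin (suc n)) → InjectOrLast i → lookup Q i ≡ not (lookup P i)
  opposite _ (inject j) = ⇔ᵇ-cancelʳ _ _ _ (begin
    lookup Q (inject₁ j) ⇔ᵇ lookup P (fromℕ n)             ≡⟨ cong (lookup Q (inject₁ j) ⇔ᵇ_) (trans (sym (not-involutive _)) (cong not (sym Qlast≡not))) ⟩
    lookup Q (inject₁ j) ⇔ᵇ not (lookup Q (fromℕ n))       ≡⟨ ⇔ᵇ-notʳ (lookup Q (inject₁ j)) (lookup Q (fromℕ n)) ⟩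
    not (lookup Q (inject₁ j) ⇔ᵇ lookup Q (fromℕ n))       ≡⟨ cong not (trans (sym (lookup-Aligned Q j)) (trans (cong (λ X → lookup X j) eq) (lookup-Aligned P j))) ⟩
    not (lookup P (inject₁ j) ⇔ᵇ lookup P (fromℕ n))       ≡⟨ ⇔ᵇ-notˡ (lookup P (inject₁ j)) (lookup P (fromℕ n)) ⟨
    not (lookup P (inject₁ j)) ⇔ᵇ lookup P (fromℕ n)       ∎)
    where open ≡-Reasoning
  opposite _ last = Qlast≡not

front : Subset (suc n) → Subset n
front P = tabulate λ j → lookup P (inject₁ j)

∣P∣≡1+∣front∣ : (P : Subset (suc n)) → lookup P (fromℕ n) ≡ true → ∣ P ∣ ≡ suc ∣ front P ∣
∣P∣≡1+∣front∣ {zero} (true ∷ []) _ = refl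
∣P∣≡1+∣front∣ {suc n} (true ∷ P) last∈P = cong suc (∣P∣≡1+∣front∣ P last∈P)
∣P∣≡1+∣front∣ {suc n} (false ∷ P) last∈P = ∣P∣≡1+∣front∣ P last∈P

∣P∣≡∣front∣ : (P : Subset (suc n)) → lookup P (fromℕ n) ≡ false → ∣ P ∣ ≡ ∣ front P ∣
∣P∣≡∣front∣ {zero} (false ∷ []) _ = refl
∣P∣≡∣front∣ {suc n} (true ∷ P) last∉P = cong suc (∣P∣≡∣front∣ P last∉P)
∣P∣≡∣front∣ {suc n} (false ∷ P) last∉P = ∣P∣≡∣front∣ P last∉P

∣Aligned∣ : ∀ {h} (P : Subset (suc n)) → ∣ P ∣ ≡ suc h → n ≡ suc (h + h) → ∣ Aligned P ∣ ≡ h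
∣Aligned∣ {n} {h} P ∣P∣≡1+h n≡1+h+h with lookup P (fromℕ n) in last∈?P
... | true = trans (cong ∣_∣ (tabulate-cong λ j → ⇔ᵇ-trueʳ (lookup P (inject₁ j))))
               (suc-injective (trans (sym (∣P∣≡1+∣front∣ P last∈?P)) ∣P∣≡1+h))
... | false = trans (cong ∣_∣ Aligned≡∁front)
                (∣p∣+c≡n⇒∣∁p∣≡c (front P) h (trans (cong (_+ h) (trans (sym (∣P∣≡∣front∣ P last∈?P)) ∣P∣≡1+h)) (sym n≡1+h+h)))
  where
  Aligned≡∁front : tabulate (λ j → lookup P (inject₁ j) ⇔ᵇ false) ≡ ∁ (front P)
  Aligned≡∁front = ≗-lookup⇒≡ λ j → begin
    lookup (tabulate (λ j → lookup P (inject₁ j) ⇔ᵇ false)) j ≡⟨ lookup∘tabulate _ j ⟩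
    lookup P (inject₁ j) ⇔ᵇ false                            ≡⟨ ⇔ᵇ-falseʳ _ ⟩
    not (lookup P (inject₁ j))                               ≡⟨ cong not (lookup∘tabulate _ j) ⟨
    not (lookup (front P) j)                                 ≡⟨ lookup-∁ (front P) j ⟨
    lookup (∁ (front P)) j                                   ∎
    where open ≡-Reasoning

lookup-∷ʳ-inject₁ : ∀ (X : Subset n) x j → lookup (X ∷ʳ x) (inject₁ j) ≡ lookup X j
lookup-∷ʳ-inject₁ (y ∷ X) x zero = refl
lookup-∷ʳ-inject₁ (y ∷ X) x (suc j) = lookup-∷ʳ-inject₁ X x j

lookup-∷ʳ-last : ∀ (X : Subset n) x → lookup (X ∷ʳ x) (fromℕ n) ≡ x
lookup-∷ʳ-last [] x = refl
lookup-∷ʳ-last (y ∷ X) x = lookup-∷ʳ-last X x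

∣∷ʳ-true∣ : (X : Subset n) → ∣ X ∷ʳ true ∣ ≡ suc ∣ X ∣
∣∷ʳ-true∣ [] = refl
∣∷ʳ-true∣ (true ∷ X) = cong suc (∣∷ʳ-true∣ X)
∣∷ʳ-true∣ (false ∷ X) = ∣∷ʳ-true∣ X

Aligned-∷ʳ-true : (X : Subset n) → Aligned (X ∷ʳ true) ≡ X
Aligned-∷ʳ-true {n} X = ≗-lookup⇒≡ λ j → begin
  lookup (Aligned (X ∷ʳ true)) j                                   ≡⟨ lookup-Aligned (X ∷ʳ true) j ⟩
  lookup (X ∷ʳ true) (inject₁ j) ⇔ᵇ lookup (X ∷ʳ true) (fromℕ n) ≡⟨ cong₂ _⇔ᵇ_ (lookup-∷ʳ-inject₁ X true j) (lookup-∷ʳ-last X true) ⟩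
  lookup X j ⇔ᵇ true                                               ≡⟨ ⇔ᵇ-trueʳ _ ⟩
  lookup X j                                                       ∎
  where open ≡-Reasoning

Aligned-swap : (P : Subset (suc n)) (j : Fin n) → lookup P (inject₁ j) ≡ not (lookup P (fromℕ n)) →
  Aligned (swapSet (inject₁ j) (fromℕ n) P) ≡ ∁ (Aligned P) [ j ]≔ false
Aligned-swap {n} P j Pj≡¬Plast = ≗-lookup⇒≡ λ j′ → trans (lookup-Aligned P′ j′) (pointwise j′)
  where
  P′ = swapSet (inject₁ j) (fromℕ n) P
  P′last : lookup P′ (fromℕ n) ≡ not (lookup P (fromℕ n))
  P′last = trans (lookup-swapSet (inject₁ j) (fromℕ n) P (fromℕ n)) (trans (cong (lookup P) (transpose-matchʳ (inject₁ j) (fromℕ n))) Pj≡¬Plast)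
  pointwise : ∀ j′ → lookup P′ (inject₁ j′) ⇔ᵇ lookup P′ (fromℕ n) ≡ lookup (∁ (Aligned P) [ j ]≔ false) j′
  pointwise j′ with j′ ≟ j
  ... | yes refl = begin
    lookup P′ (inject₁ j) ⇔ᵇ lookup P′ (fromℕ n)      ≡⟨ cong₂ _⇔ᵇ_ (trans (lookup-swapSet (inject₁ j) (fromℕ n) P (inject₁ j)) (cong (lookup P) (transpose-matchˡ (inject₁ j) (fromℕ n)))) P′last ⟩
    lookup P (fromℕ n) ⇔ᵇ not (lookup P (fromℕ n))    ≡⟨ ⇔ᵇ-not-self (lookup P (fromℕ n)) ⟩
    false                                             ≡⟨ lookup∘update j (∁ (Aligned P)) false ⟨
    lookup (∁ (Aligned P) [ j ]≔ false) j             ∎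
    where open ≡-Reasoning
  ... | no j′≢j = begin
    lookup P′ (inject₁ j′) ⇔ᵇ lookup P′ (fromℕ n)       ≡⟨ cong₂ _⇔ᵇ_ (trans (lookup-swapSet (inject₁ j) (fromℕ n) P (inject₁ j′)) (cong (lookup P) (transpose-other (inject₁ j) (fromℕ n) (j′≢j ∘ inject₁-injective) (fromℕ≢inject₁ ∘ sym)))) P′last ⟩
    lookup P (inject₁ j′) ⇔ᵇ not (lookup P (fromℕ n))   ≡⟨ ⇔ᵇ-notʳ (lookup P (inject₁ j′)) (lookup P (fromℕ n)) ⟩
    not (lookup P (inject₁ j′) ⇔ᵇ lookup P (fromℕ n))   ≡⟨ cong not (lookup-Aligned P j′) ⟨
    not (lookup (Aligned P) j′)                         ≡⟨ lookup-∁ (Aligned P) j′ ⟨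
    lookup (∁ (Aligned P)) j′                           ≡⟨ lookup∘update′ j′≢j (∁ (Aligned P)) false ⟨
    lookup (∁ (Aligned P) [ j ]≔ false) j′              ∎
    where open ≡-Reasoning

Aligned≡false⇒differ : (P : Subset (suc n)) (j : Fin n) → lookup (Aligned P) j ≡ false →
  lookup P (inject₁ j) ≡ not (lookup P (fromℕ n))
Aligned≡false⇒differ P j j∉ = ⇔ᵇ≡false⇒≡not _ _ (trans (sym (lookup-Aligned P j)) j∉)

Disjoint-∁-remove : (X : Subset n) (j : Fin n) → Disjoint X (∁ X [ j ]≔ false)
Disjoint-∁-remove X j t t∈X with t ≟ j
... | yes refl = lookup∘update t (∁ X) false
... | no t≢j = trans (lookup∘update′ t≢j (∁ X) false) (trans (lookup-∁ X t) (cong not t∈X))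

Disjoint⇒≡∁-remove : (X Y : Subset n) (j : Fin n) → Disjoint X Y → n ≡ suc (∣ X ∣ + ∣ Y ∣) →
  lookup X j ≡ false → lookup Y j ≡ false → X ≡ ∁ Y [ j ]≔ false
Disjoint⇒≡∁-remove {n} X Y j disj n≡1+∣X∣+∣Y∣ j∉X j∉Y = ≗-lookup⇒≡ pointwise
  where
  pointwise : ∀ t → lookup X t ≡ lookup (∁ Y [ j ]≔ false) t
  pointwise t with t ≟ j
  ... | yes refl = trans j∉X (sym (lookup∘update t (∁ Y) false))
  ... | no t≢j = trans (exactly-one not-both neither) (sym (trans (lookup∘update′ t≢j (∁ Y) false) (lookup-∁ Y t)))
    where
    not-both : lookup Y t ≡ true → lookup X t ≡ true → ⊥
    not-both t∈Y t∈X = true≢false (trans (sym t∈Y) (disj t t∈X))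
    neither : lookup Y t ≡ false → lookup X t ≡ false → ⊥
    neither t∉Y t∉X = <⇒≱ (subst (_< 2 + (∣ X ∣ + ∣ Y ∣)) (sym n≡1+∣X∣+∣Y∣) ≤-refl)
      (2+∣p∣+∣q∣≤n X Y j t disj (t≢j ∘ sym) j∉X j∉Y t∉X t∉Y)

transpose-↑ˡ : ∀ {k} r (a b t : Fin k) → transpose (a ↑ˡ r) (b ↑ˡ r) (t ↑ˡ r) ≡ transpose a b t ↑ˡ r
transpose-↑ˡ r a b t with transposed a b t
... | at-a = trans (transpose-matchˡ (a ↑ˡ r) (b ↑ˡ r)) (cong (_↑ˡ r) (sym (transpose-matchˡ a b)))
... | at-b = trans (transpose-matchʳ (a ↑ˡ r) (b ↑ˡ r)) (cong (_↑ˡ r) (sym (transpose-matchʳ a b)))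
... | off t≢a t≢b = trans (transpose-other (a ↑ˡ r) (b ↑ˡ r) (t≢a ∘ ↑ˡ-injective r t a) (t≢b ∘ ↑ˡ-injective r t b))
                        (cong (_↑ˡ r) (sym (transpose-other a b t≢a t≢b)))

take-swapSet-↑ˡ : ∀ k {r} (a b : Fin k) (s : Subset (k + r)) → take k (swapSet (a ↑ˡ r) (b ↑ˡ r) s) ≡ swapSet a b (take k s)
take-swapSet-↑ˡ k {r} a b s = ≗-lookup⇒≡ λ t → begin
  lookup (take k (swapSet (a ↑ˡ r) (b ↑ˡ r) s)) t   ≡⟨ lookup-take k (swapSet (a ↑ˡ r) (b ↑ˡ r) s) t ⟨
  lookup (swapSet (a ↑ˡ r) (b ↑ˡ r) s) (t ↑ˡ r)     ≡⟨ lookup-swapSet (a ↑ˡ r) (b ↑ˡ r) s (t ↑ˡ r) ⟩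
  lookup s (transpose (a ↑ˡ r) (b ↑ˡ r) (t ↑ˡ r))   ≡⟨ cong (lookup s) (transpose-↑ˡ r a b t) ⟩
  lookup s (transpose a b t ↑ˡ r)                   ≡⟨ lookup-take k s (transpose a b t) ⟩
  lookup (take k s) (transpose a b t)               ≡⟨ lookup-swapSet a b (take k s) t ⟨
  lookup (swapSet a b (take k s)) t                 ∎
  where open ≡-Reasoning

-- Degrees

open Graph

record Neighbourhood (G : Graph) (x : V G) (d : ℕ) : Set where
  field
    neighbour  : Fin d → V G
    adjacent   : ∀ i → _~_ G x (neighbour i)
    distinct   : ∀ {i j} → _≈_ G (neighbour i) (neighbour j) → i ≡ j
    exhaustive : ∀ y → _~_ G x y → ∃ λ i → _≈_ G y (neighbour i)

DistinctNeighbours : (G : Graph) → V G → ℕ → Set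
DistinctNeighbours G x p =
  Σ (Fin p → V G) λ f → (∀ i → _~_ G x (f i)) × (∀ {i j} → _≈_ G (f i) (f j) → i ≡ j)

record IsSetoidGraph (G : Graph) : Set where
  field
    isEquivalence : IsEquivalence (_≈_ G)
    ~-respʳ-≈     : _Respectsʳ_ (_~_ G) (_≈_ G)

module _ {G : Graph} (≈-equiv : IsEquivalence (_≈_ G)) where
  open IsEquivalence ≈-equiv using () renaming (sym to ≈-sym; trans to ≈-trans; reflexive to ≈-reflexive)

  neighbourhood-by-subset : ∀ {x n} (Z : Subset n) (nb : ∀ c → lookup Z c ≡ true → V G) →
    (∀ c c∈Z → _~_ G x (nb c c∈Z)) →
    (∀ c c∈Z c′ c′∈Z → _≈_ G (nb c c∈Z) (nb c′ c′∈Z) → c ≡ c′) →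
    (∀ y → _~_ G x y → ∃₂ λ c c∈Z → _≈_ G y (nb c c∈Z)) →
    Neighbourhood G x ∣ Z ∣
  neighbourhood-by-subset Z nb adj inj surj = record
    { neighbour  = λ i → nb (select Z i) (select-∈ Z i)
    ; adjacent   = λ i → adj (select Z i) (select-∈ Z i)
    ; distinct   = λ eq → select-injective Z (inj _ _ _ _ eq)
    ; exhaustive = exhaustive
    }
    where
    exhaustive : ∀ y → _~_ G _ y → ∃ λ i → _≈_ G y (nb (select Z i) (select-∈ Z i))
    exhaustive y x~y with surj y x~y
    ... | c , c∈Z , y≈c with select-surjective Z c c∈Z
    ...   | i , refl = i , ≈-trans y≈c (≈-reflexive (cong (nb c) (Decidable⇒UIP.≡-irrelevant _≟ᵇ_ c∈Z (select-∈ Z i))))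

  distinct≤degree : ∀ {x d p} → Neighbourhood G x d → DistinctNeighbours G x p → p ≤ d
  distinct≤degree {x} N (f , adj , inj) = injective⇒≤ index-injective
    where
    open Neighbourhood N
    index : _ → Fin _
    index i = proj₁ (exhaustive (f i) (adj i))
    index-injective : ∀ {i j} → index i ≡ index j → i ≡ j
    index-injective {i} {j} eq with exhaustive (f i) (adj i) | exhaustive (f j) (adj j)
    index-injective refl | _ , fi≈ | _ , fj≈ = inj (≈-trans fi≈ (≈-sym fj≈))

neighbourhood⇒distinct : ∀ {G x d} → Neighbourhood G x d → DistinctNeighbours G x d
neighbourhood⇒distinct N = neighbour , adjacent , distinct
  where open Neighbourhood N

module _ {G H : Graph} (I : G ≅ H) where
  open _≅_ I

  ≅-distinct : ∀ {x p} → DistinctNeighbours G x p → DistinctNeighbours H (to x) p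
  ≅-distinct (f , adj , inj) = (λ i → to (f i)) , (λ i → adj⇒ (adj i)) , λ eq → inj (to-inj eq)

  ≅-distinct⁻ : IsSetoidGraph H → ∀ {x p} → DistinctNeighbours H (to x) p → DistinctNeighbours G x p
  ≅-distinct⁻ H-setoid (f , adj , inj) =
    (λ i → preimage i) ,
    (λ i → adj⇐ (~-respʳ-≈ (≈-sym (to-preimage i)) (adj i))) ,
    λ eq → inj (≈-trans (≈-sym (to-preimage _)) (≈-trans (to-cong eq) (to-preimage _)))
    where
    open IsSetoidGraph H-setoid using (~-respʳ-≈)
    open IsEquivalence (IsSetoidGraph.isEquivalence H-setoid) using () renaming (sym to ≈-sym; trans to ≈-trans)
    preimage : ∀ i → V G
    preimage i = proj₁ (to-surj (f i))
    to-preimage : ∀ i → _≈_ H (to (preimage i)) (f i)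
    to-preimage i = proj₂ (to-surj (f i))

  ≅-degree : IsEquivalence (_≈_ G) → IsSetoidGraph H →
    ∀ {x d d′} → Neighbourhood G x d → Neighbourhood H (to x) d′ → d ≡ d′
  ≅-degree G-equiv H-setoid NG NH = ≤-antisym
    (distinct≤degree (IsSetoidGraph.isEquivalence H-setoid) NH (≅-distinct (neighbourhood⇒distinct NG)))
    (distinct≤degree G-equiv NG (≅-distinct⁻ H-setoid (neighbourhood⇒distinct NH)))

-- The middle levels graph

N-suc : ∀ m → N (suc m) ≡ suc (m + m)
N-suc m = trans (cong (λ z → m + suc z) (+-identityʳ m)) (+-suc m m)

m+m≡n+n⇒m≡n : ∀ {m n} → m + m ≡ n + n → m ≡ n
m+m≡n+n⇒m≡n {zero} {zero} _ = refl
m+m≡n+n⇒m≡n {suc m} {suc n} eq =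
  cong suc (m+m≡n+n⇒m≡n (suc-injective (trans (sym (+-suc m m)) (trans (suc-injective eq) (+-suc n n)))))

B-isSetoidGraph : ∀ m → IsSetoidGraph (B m)
B-isSetoidGraph m = record
  { isEquivalence = record { refl = refl ; sym = sym ; trans = λ {_} {_} {_} → trans }
  ; ~-respʳ-≈ = λ {u} {v} {w} → adj-respʳ {u} {v} {w}
  }
  where
  adj-respʳ : ∀ {u v w : BVert m} → proj₁ v ≡ proj₁ w → BAdj m u v → BAdj m u w
  adj-respʳ {v = s , _} {w = .s , _} refl u~v = u~v

B-neighbourhood : ∀ m (T : BVert (suc m)) → Neighbourhood (B (suc m)) T (suc m)
B-neighbourhood m (T , inj₁ ∣T∣≡m) = subst (Neighbourhood (B (suc m)) _) ∣∁T∣≡1+m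
  (neighbourhood-by-subset (IsSetoidGraph.isEquivalence (B-isSetoidGraph (suc m))) (∁ T) up up-adjacent
     (λ c c∉T c′ _ eq → insert-injective T c c′ (∈∁⇒∉ T c c∉T) eq) up-exhaustive)
  where
  ∣T+c∣≡1+m : ∀ c → lookup (∁ T) c ≡ true → ∣ T [ c ]≔ true ∣ ≡ suc m
  ∣T+c∣≡1+m c c∉T = trans (∣insert∣ T c (∈∁⇒∉ T c c∉T)) (cong suc ∣T∣≡m)
  up : ∀ c → lookup (∁ T) c ≡ true → BVert (suc m)
  up c c∉T = T [ c ]≔ true , inj₂ (∣T+c∣≡1+m c c∉T)
  up-adjacent : ∀ c c∉T → BAdj (suc m) (T , inj₁ ∣T∣≡m) (up c c∉T)
  up-adjacent c c∉T = inj₁ (∣T∣≡m , ∣T+c∣≡1+m c c∉T , ⊆ᵇ⇒⊆ (∈-insert T c))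
  up-exhaustive : ∀ Y → BAdj (suc m) (T , inj₁ ∣T∣≡m) Y →
    Σ (Fin _) λ c → Σ (lookup (∁ T) c ≡ true) λ c∉T → proj₁ Y ≡ proj₁ (up c c∉T)
  up-exhaustive (Y , _) (inj₂ (∣Y∣≡m , ∣T∣≡1+m , _)) = ⊥-elim (1+n≢n (trans (sym ∣T∣≡1+m) ∣T∣≡m))
  up-exhaustive (Y , _) (inj₁ (_ , ∣Y∣≡1+m , T⊆Y))
    with ∣p∣<∣q∣⇒∃∈q∖p T Y (subst₂ _<_ (sym ∣T∣≡m) (sym ∣Y∣≡1+m) ≤-refl)
  ... | c , c∈Y , c∉T = c , ∉⇒∈∁ T c c∉T ,
    sym (⊆ᵇ∧∣q∣≤∣p∣⇒≡ (T [ c ]≔ true) Y T+c⊆Y (≤-reflexive (trans ∣Y∣≡1+m (sym (∣T+c∣≡1+m c (∉⇒∈∁ T c c∉T))))))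
    where
    T+c⊆Y : (T [ c ]≔ true) ⊆ᵇ Y
    T+c⊆Y t t∈T+c with t ≟ c
    ... | yes refl = c∈Y
    ... | no t≢c = ⊆⇒⊆ᵇ T⊆Y t (∈-insert⁻ T c t t∈T+c t≢c)
  ∣∁T∣≡1+m : ∣ ∁ T ∣ ≡ suc m
  ∣∁T∣≡1+m = +-cancelʳ-≡ ∣ T ∣ _ _ (trans (∣∁p∣+∣p∣≡n T) (trans (N-suc m) (sym (cong (suc m +_) ∣T∣≡m))))
B-neighbourhood m (T , inj₂ ∣T∣≡1+m) = subst (Neighbourhood (B (suc m)) _) ∣T∣≡1+m
  (neighbourhood-by-subset (IsSetoidGraph.isEquivalence (B-isSetoidGraph (suc m))) T down down-adjacent
     (λ c c∈T c′ _ eq → remove-injective T c c′ c∈T eq) down-exhaustive)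
  where
  ∣T-c∣≡m : ∀ c → lookup T c ≡ true → ∣ T [ c ]≔ false ∣ ≡ m
  ∣T-c∣≡m c c∈T = suc-injective (trans (∣remove∣ T c c∈T) ∣T∣≡1+m)
  down : ∀ c → lookup T c ≡ true → BVert (suc m)
  down c c∈T = T [ c ]≔ false , inj₁ (∣T-c∣≡m c c∈T)
  down-adjacent : ∀ c c∈T → BAdj (suc m) (T , inj₂ ∣T∣≡1+m) (down c c∈T)
  down-adjacent c c∈T = inj₂ (∣T-c∣≡m c c∈T , ∣T∣≡1+m , ⊆ᵇ⇒⊆ (∈-remove⁻ T c))
  down-exhaustive : ∀ Y → BAdj (suc m) (T , inj₂ ∣T∣≡1+m) Y →
    Σ (Fin _) λ c → Σ (lookup T c ≡ true) λ c∈T → proj₁ Y ≡ proj₁ (down c c∈T)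
  down-exhaustive (Y , _) (inj₁ (∣T∣≡m , _)) = ⊥-elim (1+n≢n (trans (sym ∣T∣≡1+m) ∣T∣≡m))
  down-exhaustive (Y , _) (inj₂ (∣Y∣≡m , _ , Y⊆T))
    with ∣p∣<∣q∣⇒∃∈q∖p Y T (subst₂ _<_ (sym ∣Y∣≡m) (sym ∣T∣≡1+m) ≤-refl)
  ... | c , c∈T , c∉Y = c , c∈T ,
    ⊆ᵇ∧∣q∣≤∣p∣⇒≡ Y (T [ c ]≔ false) Y⊆T-c (≤-reflexive (trans (∣T-c∣≡m c c∈T) (sym ∣Y∣≡m)))
    where
    Y⊆T-c : Y ⊆ᵇ (T [ c ]≔ false)
    Y⊆T-c t t∈Y with t ≟ c
    ... | yes refl = ⊥-elim (true≢false (trans (sym t∈Y) c∉Y))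
    ... | no t≢c = ∈-remove T c t (⊆⇒⊆ᵇ Y⊆T t t∈Y) t≢c

-- O_n([k]) and M_n(k) over an arbitrary ground set Fin L and vertex size s; M n k is definitionally
-- Restricted.𝓜 (N n) (n ∸ 1) k, which lets the structure theory below work over Fin (k + r).
module Restricted (L s k : ℕ) where

  Vertex : Set
  Vertex = Σ (Subset L) (λ v → ∣ v ∣ ≡ s)

  Edgeˢ : Subset L → Subset L → Set
  Edgeˢ u v = (Empty (u ∩ v) × u ≢ v) × (∀ (c : Fin L) → c ∉ u → c ∉ v → k ≤ toℕ c)

  Edge : Vertex → Vertex → Set
  Edge u v = Edgeˢ (proj₁ u) (proj₁ v)

  Connected : Vertex → Vertex → Set
  Connected = Star Edge

  ComponentGraph : Vertex → Graph
  ComponentGraph v = record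
    { V   = Σ Vertex (Connected v)
    ; _≈_ = λ x y → proj₁ (proj₁ x) ≡ proj₁ (proj₁ y)
    ; _~_ = λ x y → Edge (proj₁ x) (proj₁ y)
    }

  IsMiddle : Vertex → Set
  IsMiddle v = ∃ λ m → 1 ≤ m × (ComponentGraph v ≅ B m)

  MVertex : Set
  MVertex = Σ Vertex IsMiddle

  MEdge : MVertex → MVertex → Set
  MEdge x y =
      ¬ Connected (proj₁ x) (proj₁ y)
    × ∃ λ (a : Fin L) → ∃ λ (kk : Fin L) →
        toℕ a < k ∸ 1 × toℕ kk ≡ k ∸ 1 ×
        (∀ (w : Vertex) →
            (Connected (proj₁ y) w →
               Σ Vertex (λ w′ → Connected (proj₁ x) w′ × swapSet a kk (proj₁ w′) ≡ proj₁ w))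
          × (Σ Vertex (λ w′ → Connected (proj₁ x) w′ × swapSet a kk (proj₁ w′) ≡ proj₁ w) →
               Connected (proj₁ y) w))

  𝓜 : Graph
  𝓜 = record { V = MVertex ; _≈_ = λ x y → Connected (proj₁ x) (proj₁ y) ; _~_ = MEdge }

  Vertex-≡ : {u v : Vertex} → proj₁ u ≡ proj₁ v → u ≡ v
  Vertex-≡ {u = p , ∣p∣≡s} {.p , ∣p∣≡s′} refl = cong (p ,_) (≡-irrelevant ∣p∣≡s ∣p∣≡s′)

  Connected-≈ʳ : ∀ {u v v′} → Connected u v → proj₁ v ≡ proj₁ v′ → Connected u v′
  Connected-≈ʳ {u} u⋯v eq = subst (Connected u) (Vertex-≡ eq) u⋯v

  Connected-≈ˡ : ∀ {u u′ v} → proj₁ u ≡ proj₁ u′ → Connected u v → Connected u′ v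
  Connected-≈ˡ {v = v} eq u⋯v = subst (λ u → Connected u v) (Vertex-≡ eq) u⋯v

  module _ (L≡1+s+s : L ≡ suc (s + s)) (0<s : 0 < s) where

    ∣∁insert∣ : ∀ (w : Vertex) c → lookup (proj₁ w) c ≡ false → ∣ ∁ (proj₁ w [ c ]≔ true) ∣ ≡ s
    ∣∁insert∣ (w , ∣w∣≡s) c c∉w = ∣p∣+c≡n⇒∣∁p∣≡c (w [ c ]≔ true) s
      (trans (cong (_+ s) (trans (∣insert∣ w c c∉w) (cong suc ∣w∣≡s))) (sym L≡1+s+s))

    -- The neighbours of w are the complements of w ∪ {c} for c ∉ w; the colour of that edge is c.
    complementWith : ∀ (w : Vertex) c → lookup (proj₁ w) c ≡ false → Vertex
    complementWith w c c∉w = ∁ (proj₁ w [ c ]≔ true) , ∣∁insert∣ w c c∉w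

    complementWith-edge : ∀ (w : Vertex) c (c∉w : lookup (proj₁ w) c ≡ false) → k ≤ toℕ c → Edge w (complementWith w c c∉w)
    complementWith-edge (w , ∣w∣≡s) c c∉w k≤c = (Disjoint⇒Empty-∩ w w′ w∩w′≡∅ , w≢w′) , colour
      where
      w′ = ∁ (w [ c ]≔ true)
      w∩w′≡∅ : Disjoint w w′
      w∩w′≡∅ = ⊆ᵇ⇒Disjoint-∁ʳ w (w [ c ]≔ true) (∈-insert w c)
      w≢w′ : w ≢ w′
      w≢w′ w≡w′ with 0<∣p∣⇒∃∈ w (subst (0 <_) (sym ∣w∣≡s) 0<s)
      ... | t , t∈w = true≢false (trans (sym t∈w) (trans (cong (λ x → lookup x t) w≡w′) (w∩w′≡∅ t t∈w)))
      colour : ∀ t → t ∉ w → t ∉ w′ → k ≤ toℕ t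
      colour t t∉w t∉w′ with t ≟ c
      ... | yes refl = k≤c
      ... | no t≢c = ⊥-elim (t∉w′ (lookup⇒[]= t w′ (∉⇒∈∁ (w [ c ]≔ true) t
              (trans (lookup∘update′ t≢c w true) (∉⇒lookup≡false w t∉w)))))

    edge⇒complementWith : ∀ (w y : Vertex) → Edge w y →
      ∃ λ c → Σ (lookup (proj₁ w) c ≡ false) λ c∉w → k ≤ toℕ c × proj₁ y ≡ proj₁ (complementWith w c c∉w)
    edge⇒complementWith (w , ∣w∣≡s) (y , ∣y∣≡s) ((empty , _) , colour) with commonHole⊎Covering w y
    ... | inj₂ cover = ⊥-elim (1+n≢n (begin
      suc (s + s)      ≡⟨ L≡1+s+s ⟨
      L                ≡⟨ ∣p∣+∣q∣≡n w y w∩y≡∅ cover ⟨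
      ∣ w ∣ + ∣ y ∣    ≡⟨ cong₂ _+_ ∣w∣≡s ∣y∣≡s ⟩
      s + s            ∎))
      where
      open ≡-Reasoning
      w∩y≡∅ = Empty-∩⇒Disjoint w y empty
    ... | inj₁ (c , c∉w , c∉y) = c , c∉w , colour c (lookup≡false⇒∉ w c∉w) (lookup≡false⇒∉ y c∉y) ,
      ⊆ᵇ∧∣q∣≤∣p∣⇒≡ y (∁ (w [ c ]≔ true)) y⊆ (≤-reflexive (trans (∣∁insert∣ (w , ∣w∣≡s) c c∉w) (sym ∣y∣≡s)))
      where
      y⊆ : y ⊆ᵇ ∁ (w [ c ]≔ true)
      y⊆ t t∈y with t ≟ c
      ... | yes refl = ⊥-elim (true≢false (trans (sym t∈y) c∉y))
      ... | no t≢c = ∉⇒∈∁ (w [ c ]≔ true) t (trans (lookup∘update′ t≢c w true)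
              (≢true⇒≡false λ t∈w → true≢false (trans (sym t∈y) (Empty-∩⇒Disjoint w y empty t t∈w))))

-- O_n([k]) for k = 2h + 2 and n = h + m + 2 on the ground set Fin (k + r), r = 2m + 1; K w and R w
-- are the traces of w on [k] and on the remaining r elements.
module Split (h m : ℕ) where

  open Graph

  k r : ℕ
  k = suc (N (suc h))
  r = N (suc m)

  open Restricted (k + r) (h + suc m) k public

  k≡1+h+1+h : k ≡ suc h + suc h
  k≡1+h+1+h = cong suc (trans (N-suc h) (sym (+-suc h h)))

  K : Vertex → Subset k
  K w = take k (proj₁ w)

  R : Vertex → Subset r
  R w = drop k (proj₁ w)

  ∣K∣+∣R∣≡size : ∀ w → ∣ K w ∣ + ∣ R w ∣ ≡ h + suc m
  ∣K∣+∣R∣≡size w = trans (sym (∣p∣≡∣take∣+∣drop∣ k (proj₁ w))) (proj₂ w)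

  edgeˢ⇒ : ∀ p q → Edgeˢ p q → take k q ≡ ∁ (take k p) × Disjoint (drop k p) (drop k q)
  edgeˢ⇒ p q ((empty , _) , colour) = ≗-lookup⇒≡ complementary , disjoint
    where
    p∩q≡∅ : Disjoint p q
    p∩q≡∅ = Empty-∩⇒Disjoint p q empty
    complementary : ∀ i → lookup (take k q) i ≡ lookup (∁ (take k p)) i
    complementary i = begin
      lookup (take k q) i       ≡⟨ lookup-take k q i ⟨
      lookup q (i ↑ˡ r)         ≡⟨ exactly-one not-both neither ⟩
      not (lookup p (i ↑ˡ r))   ≡⟨ cong not (lookup-take k p i) ⟩
      not (lookup (take k p) i) ≡⟨ lookup-∁ (take k p) i ⟨
      lookup (∁ (take k p)) i   ∎
      where
      open ≡-Reasoning
      not-both : lookup p (i ↑ˡ r) ≡ true → lookup q (i ↑ˡ r) ≡ true → ⊥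
      not-both c∈p c∈q = true≢false (trans (sym c∈q) (p∩q≡∅ _ c∈p))
      neither : lookup p (i ↑ˡ r) ≡ false → lookup q (i ↑ˡ r) ≡ false → ⊥
      neither c∉p c∉q = <⇒≱ (subst (_< k) (sym (toℕ-↑ˡ i r)) (toℕ<n i)) (colour _ (lookup≡false⇒∉ p c∉p) (lookup≡false⇒∉ q c∉q))
    disjoint : Disjoint (drop k p) (drop k q)
    disjoint t t∈p = trans (sym (lookup-drop k q t)) (p∩q≡∅ (k ↑ʳ t) (trans (lookup-drop k p t) t∈p))

  edge⇒ : ∀ {u v} → Edge u v → K v ≡ ∁ (K u) × Disjoint (R u) (R v)
  edge⇒ {u} {v} = edgeˢ⇒ (proj₁ u) (proj₁ v)

  edgeˢ⇐ : ∀ p q → take k q ≡ ∁ (take k p) → Disjoint (drop k p) (drop k q) → Edgeˢ p q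
  edgeˢ⇐ p q complementary disjoint = (Disjoint⇒Empty-∩ p q p∩q≡∅ , p≢q) , colour
    where
    complementaryᵢ : ∀ i → lookup q (i ↑ˡ r) ≡ not (lookup p (i ↑ˡ r))
    complementaryᵢ i = begin
      lookup q (i ↑ˡ r)         ≡⟨ lookup-take k q i ⟩
      lookup (take k q) i       ≡⟨ cong (λ x → lookup x i) complementary ⟩
      lookup (∁ (take k p)) i   ≡⟨ lookup-∁ (take k p) i ⟩
      not (lookup (take k p) i) ≡⟨ cong not (lookup-take k p i) ⟨
      not (lookup p (i ↑ˡ r))   ∎
      where open ≡-Reasoning
    p∩q≡∅ : Disjoint p q
    p∩q≡∅ c c∈p with splitView k c
    ... | left i = trans (complementaryᵢ i) (cong not c∈p)
    ... | right t = trans (lookup-drop k q t) (disjoint t (trans (sym (lookup-drop k p t)) c∈p))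
    p≢q : p ≢ q
    p≢q refl = p≢∁p (take k p) complementary
    colour : ∀ c → c ∉ p → c ∉ q → k ≤ toℕ c
    colour c c∉p c∉q with splitView k c
    ... | left i = ⊥-elim (c∉q (lookup⇒[]= _ q (trans (complementaryᵢ i) (cong not (∉⇒lookup≡false p c∉p)))))
    ... | right t = ≤-trans (m≤m+n k (toℕ t)) (≤-reflexive (sym (toℕ-↑ʳ k t)))

  ++-edge : (P Q : Subset k) {A B : Subset r} → Q ≡ ∁ P → Disjoint A B → Edgeˢ (P ++ A) (Q ++ B)
  ++-edge P Q {A} {B} Q≡∁P disjoint = edgeˢ⇐ (P ++ A) (Q ++ B)
    (trans (take-++ Q B) (trans Q≡∁P (cong ∁ (sym (take-++ P A)))))
    (subst₂ Disjoint (sym (drop-++ P A)) (sym (drop-++ Q B)) disjoint)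

  SameSide OppositeSide Side : Vertex → Vertex → Set
  SameSide u w = K w ≡ K u
  OppositeSide u w = K w ≡ ∁ (K u)
  Side u w = SameSide u w ⊎ OppositeSide u w

  connected⇒side : ∀ {u w} → Connected u w → Side u w
  connected⇒side ε = inj₁ refl
  connected⇒side {u} (_◅_ {j = v} u~v v⋯w) with connected⇒side v⋯w | proj₁ (edge⇒ {u} {v} u~v)
  ... | inj₁ same | Kv≡∁Ku = inj₂ (trans same Kv≡∁Ku)
  ... | inj₂ opposite | Kv≡∁Ku = inj₁ (trans opposite (trans (cong ∁ Kv≡∁Ku) (∁-involutive (K u))))

  ¬same×opposite : ∀ {u w} → SameSide u w → OppositeSide u w → ⊥
  ¬same×opposite {u} same opposite = p≢∁p (K u) (trans (sym same) opposite)

  Balanced : Vertex → Set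
  Balanced u = ∣ K u ∣ ≡ suc h

  ∣∁P∣≡1+h : (P : Subset k) → ∣ P ∣ ≡ suc h → ∣ ∁ P ∣ ≡ suc h
  ∣∁P∣≡1+h P ∣P∣≡1+h = ∣p∣+c≡n⇒∣∁p∣≡c P (suc h) (trans (cong (_+ suc h) ∣P∣≡1+h) (sym k≡1+h+1+h))

  ∣∁A∣≡m : (A : Subset r) → ∣ A ∣ ≡ suc m → ∣ ∁ A ∣ ≡ m
  ∣∁A∣≡m A ∣A∣≡1+m = ∣p∣+c≡n⇒∣∁p∣≡c A m (trans (cong (_+ m) ∣A∣≡1+m) (sym (N-suc m)))

  ∣∁A∣≡1+m : (A : Subset r) → ∣ A ∣ ≡ m → ∣ ∁ A ∣ ≡ suc m
  ∣∁A∣≡1+m A ∣A∣≡m = ∣p∣+c≡n⇒∣∁p∣≡c A (suc m) (trans (cong (_+ suc m) ∣A∣≡m) (trans (+-suc m m) (sym (N-suc m))))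

  side-sizes : ∀ {u w} → Balanced u → Side u w → ∣ K w ∣ ≡ suc h × ∣ R w ∣ ≡ m
  side-sizes {u} {w} ∣Ku∣≡1+h side = ∣Kw∣≡1+h side ,
    +-cancelˡ-≡ (suc h) _ _ (trans (cong (_+ ∣ R w ∣) (sym (∣Kw∣≡1+h side))) (trans (∣K∣+∣R∣≡size w) (+-suc h m)))
    where
    ∣Kw∣≡1+h : Side u w → ∣ K w ∣ ≡ suc h
    ∣Kw∣≡1+h (inj₁ same) = trans (cong ∣_∣ same) ∣Ku∣≡1+h
    ∣Kw∣≡1+h (inj₂ opposite) = trans (cong ∣_∣ opposite) (∣∁P∣≡1+h (K u) ∣Ku∣≡1+h)

  balancedVertex : (P : Subset k) → ∣ P ∣ ≡ suc h → (A : Subset r) → ∣ A ∣ ≡ m → Vertex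
  balancedVertex P ∣P∣≡1+h A ∣A∣≡m = P ++ A , trans (∣++∣ P A) (trans (cong₂ _+_ ∣P∣≡1+h ∣A∣≡m) (sym (+-suc h m)))

  exchange⇒connected : (P : Subset k) (∣P∣≡1+h : ∣ P ∣ ≡ suc h) {A A′ : Subset r} → Exchange A A′ →
    (∣A∣≡m : ∣ A ∣ ≡ m) (∣A′∣≡m : ∣ A′ ∣ ≡ m) →
    Connected (balancedVertex P ∣P∣≡1+h A ∣A∣≡m) (balancedVertex P ∣P∣≡1+h A′ ∣A′∣≡m)
  exchange⇒connected P ∣P∣≡1+h {A} {A′} (j , j∉A , A′⊆A+j , _) ∣A∣≡m ∣A′∣≡m =
    _◅_ {j = middle} (++-edge P (∁ P) refl (⊆ᵇ⇒Disjoint-∁ʳ A (A [ j ]≔ true) (∈-insert A j)))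
      (++-edge (∁ P) P (sym (∁-involutive P)) (⊆ᵇ⇒Disjoint-∁ˡ A′ (A [ j ]≔ true) A′⊆A+j) ◅ ε)
    where
    middle : Vertex
    middle = balancedVertex (∁ P) (∣∁P∣≡1+h P ∣P∣≡1+h) (∁ (A [ j ]≔ true))
               (∣∁A∣≡m (A [ j ]≔ true) (trans (∣insert∣ A j j∉A) (cong suc ∣A∣≡m)))

  exchanges⇒connected : (P : Subset k) (∣P∣≡1+h : ∣ P ∣ ≡ suc h) {A A′ : Subset r} → Star Exchange A A′ →
    (∣A∣≡m : ∣ A ∣ ≡ m) (∣A′∣≡m : ∣ A′ ∣ ≡ m) →
    Connected (balancedVertex P ∣P∣≡1+h A ∣A∣≡m) (balancedVertex P ∣P∣≡1+h A′ ∣A′∣≡m)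
  exchanges⇒connected P ∣P∣≡1+h ε ∣A∣≡m ∣A′∣≡m = Connected-≈ʳ ε refl
  exchanges⇒connected P ∣P∣≡1+h (e@(_ , _ , _ , ∣A₁∣≡∣A∣) ◅ es) ∣A∣≡m ∣A′∣≡m =
    exchange⇒connected P ∣P∣≡1+h e ∣A∣≡m (trans ∣A₁∣≡∣A∣ ∣A∣≡m)
      ◅◅ exchanges⇒connected P ∣P∣≡1+h es (trans ∣A₁∣≡∣A∣ ∣A∣≡m) ∣A′∣≡m

  K++R : ∀ w → K w ++ R w ≡ proj₁ w
  K++R w = take++drop≡id k (proj₁ w)

  same⇒connected : ∀ {u w} → Balanced u → SameSide u w → Connected u w
  same⇒connected {u} {w} ∣Ku∣≡1+h same =
    Connected-≈ˡ (K++R u) (Connected-≈ʳ u⋯w (trans (cong (_++ R w) (sym same)) (K++R w)))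
    where
    ∣Ru∣≡m = proj₂ (side-sizes {u} {u} ∣Ku∣≡1+h (inj₁ refl))
    ∣Rw∣≡m = proj₂ (side-sizes {u} {w} ∣Ku∣≡1+h (inj₁ same))
    u⋯w = exchanges⇒connected (K u) ∣Ku∣≡1+h (exchanges (R u) (R w) (trans ∣Ru∣≡m (sym ∣Rw∣≡m))) ∣Ru∣≡m ∣Rw∣≡m

  opposite⇒connected : ∀ {u w} → Balanced u → OppositeSide u w → Connected u w
  opposite⇒connected {u} {w} ∣Ku∣≡1+h opposite with ∣p∣<n⇒∃∉ (R u) ∣Ru∣<r
    where
    ∣Ru∣<r : ∣ R u ∣ < r
    ∣Ru∣<r = subst₂ _<_ (sym (proj₂ (side-sizes {u} {u} ∣Ku∣≡1+h (inj₁ refl)))) (sym (N-suc m)) (s≤s (m≤m+n m m))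
  ... | j , j∉Ru = _◅_ {j = v} u~v (same⇒connected {v} {w} ∣Kv∣≡1+h (trans opposite (sym Kv≡∁Ku)))
    where
    ∣Ru+j∣≡1+m = trans (∣insert∣ (R u) j j∉Ru) (cong suc (proj₂ (side-sizes {u} {u} ∣Ku∣≡1+h (inj₁ refl))))
    v : Vertex
    v = balancedVertex (∁ (K u)) (∣∁P∣≡1+h (K u) ∣Ku∣≡1+h) (∁ (R u [ j ]≔ true)) (∣∁A∣≡m (R u [ j ]≔ true) ∣Ru+j∣≡1+m)
    Kv≡∁Ku : K v ≡ ∁ (K u)
    Kv≡∁Ku = take-++ (∁ (K u)) (∁ (R u [ j ]≔ true))
    ∣Kv∣≡1+h : Balanced v
    ∣Kv∣≡1+h = trans (cong ∣_∣ Kv≡∁Ku) (∣∁P∣≡1+h (K u) ∣Ku∣≡1+h)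
    u~v : Edge u v
    u~v = subst (λ p → Edgeˢ p (proj₁ v)) (K++R u)
      (++-edge (K u) (∁ (K u)) refl (⊆ᵇ⇒Disjoint-∁ʳ (R u) (R u [ j ]≔ true) (∈-insert (R u) j)))

  side⇒connected : ∀ {u w} → Balanced u → Side u w → Connected u w
  side⇒connected {u} {w} ∣Ku∣≡1+h (inj₁ same) = same⇒connected {u} {w} ∣Ku∣≡1+h same
  side⇒connected {u} {w} ∣Ku∣≡1+h (inj₂ opposite) = opposite⇒connected {u} {w} ∣Ku∣≡1+h opposite

  k+r≡1+s+s : k + r ≡ suc ((h + suc m) + (h + suc m))
  k+r≡1+s+s = trans (cong₂ (λ x y → suc x + y) (N-suc h) (N-suc m)) (rearrange h m)
    where
    rearrange : ∀ h m → suc (suc (h + h)) + suc (m + m) ≡ suc ((h + suc m) + (h + suc m))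
    rearrange = solve-∀

  0<size : 0 < h + suc m
  0<size = subst (0 <_) (sym (+-suc h m)) (s≤s z≤n)

  ComponentGraph-≈-equiv : ∀ u → IsEquivalence (_≈_ (ComponentGraph u))
  ComponentGraph-≈-equiv u = record { refl = refl ; sym = sym ; trans = λ {_} {_} {_} → trans }

  k≤k↑ʳt : ∀ (t : Fin r) → k ≤ toℕ (k ↑ʳ t)
  k≤k↑ʳt t = subst (k ≤_) (sym (toℕ-↑ʳ k t)) (m≤m+n k (toℕ t))

  component-neighbourhood : ∀ u (x : V (ComponentGraph u)) →
    Neighbourhood (ComponentGraph u) x ∣ ∁ (R (proj₁ x)) ∣
  component-neighbourhood u (w , u⋯w) =
    neighbourhood-by-subset (ComponentGraph-≈-equiv u) (∁ (R w)) neighbour adjacent distinct exhaustive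
    where
    k↑ʳt∉w : ∀ t → lookup (∁ (R w)) t ≡ true → lookup (proj₁ w) (k ↑ʳ t) ≡ false
    k↑ʳt∉w t t∉Rw = trans (lookup-drop k (proj₁ w) t) (∈∁⇒∉ (R w) t t∉Rw)
    complementWithᵣ : ∀ t → lookup (∁ (R w)) t ≡ true → Vertex
    complementWithᵣ t t∉Rw = complementWith k+r≡1+s+s 0<size w (k ↑ʳ t) (k↑ʳt∉w t t∉Rw)
    adjacent : ∀ t t∉Rw → Edge w (complementWithᵣ t t∉Rw)
    adjacent t t∉Rw = complementWith-edge k+r≡1+s+s 0<size w (k ↑ʳ t) (k↑ʳt∉w t t∉Rw) (k≤k↑ʳt t)
    neighbour : ∀ t → lookup (∁ (R w)) t ≡ true → V (ComponentGraph u)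
    neighbour t t∉Rw = complementWithᵣ t t∉Rw , u⋯w ◅◅ (adjacent t t∉Rw ◅ ε)
    distinct : ∀ t t∉Rw t′ t′∉Rw → proj₁ (complementWithᵣ t t∉Rw) ≡ proj₁ (complementWithᵣ t′ t′∉Rw) → t ≡ t′
    distinct t t∉Rw t′ _ eq = ↑ʳ-injective k t t′
      (insert-injective (proj₁ w) (k ↑ʳ t) (k ↑ʳ t′) (k↑ʳt∉w t t∉Rw) (∁-injective eq))
    exhaustive : ∀ (y : V (ComponentGraph u)) → Edge w (proj₁ y) →
      ∃ λ t → Σ (lookup (∁ (R w)) t ≡ true) λ t∉Rw → proj₁ (proj₁ y) ≡ proj₁ (complementWithᵣ t t∉Rw)
    exhaustive (y , _) w~y with edge⇒complementWith k+r≡1+s+s 0<size w y w~y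
    ... | c , c∉w , k≤c , y≡complementWith with splitView k c
    ...   | left i = ⊥-elim (<⇒≱ (subst (_< k) (sym (toℕ-↑ˡ i r)) (toℕ<n i)) k≤c)
    ...   | right t = t , ∉⇒∈∁ (R w) t (trans (sym (lookup-drop k (proj₁ w) t)) c∉w) , y≡complementWith

  -- B (m₁ + 1) is regular, so u and a neighbour y have equal degrees |∁ (R u)| = |∁ (R y)|; since
  -- |K y| = |∁ (K u)| and both vertices have the same size, |K u| = |∁ (K u)|.
  isMiddle⇒balanced : ∀ u → IsMiddle u → Balanced u
  isMiddle⇒balanced u (suc m₁ , _ , I) = m+m≡n+n⇒m≡n (begin
    ∣ K u ∣ + ∣ K u ∣       ≡⟨ cong (_+ ∣ K u ∣) ∣Ku∣≡∣∁Ku∣ ⟩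
    ∣ ∁ (K u) ∣ + ∣ K u ∣   ≡⟨ ∣∁p∣+∣p∣≡n (K u) ⟩
    k                       ≡⟨ k≡1+h+1+h ⟩
    suc h + suc h           ∎)
    where
    open ≡-Reasoning
    degree : ∀ x → ∣ ∁ (R (proj₁ x)) ∣ ≡ suc m₁
    degree x = ≅-degree I (ComponentGraph-≈-equiv u) (B-isSetoidGraph (suc m₁))
      (component-neighbourhood u x) (B-neighbourhood m₁ (_≅_.to I x))
    origin : V (ComponentGraph u)
    origin = u , ε
    open Neighbourhood (component-neighbourhood u origin)
    first : Fin ∣ ∁ (R u) ∣
    first = subst Fin (sym (degree origin)) zero
    y : Vertex
    y = proj₁ (neighbour first)
    ∣Ru∣≡∣Ry∣ : ∣ R u ∣ ≡ ∣ R y ∣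
    ∣Ru∣≡∣Ry∣ = ∣∁p∣≡∣∁q∣⇒∣p∣≡∣q∣ (R u) (R y) (trans (degree origin) (sym (degree (neighbour first))))
    ∣Ku∣≡∣∁Ku∣ : ∣ K u ∣ ≡ ∣ ∁ (K u) ∣
    ∣Ku∣≡∣∁Ku∣ = +-cancelʳ-≡ ∣ R u ∣ _ _ (begin
      ∣ K u ∣ + ∣ R u ∣       ≡⟨ ∣K∣+∣R∣≡size u ⟩
      h + suc m               ≡⟨ ∣K∣+∣R∣≡size y ⟨
      ∣ K y ∣ + ∣ R y ∣       ≡⟨ cong₂ _+_ (cong ∣_∣ (proj₁ (edge⇒ {u} {y} (adjacent first)))) (sym ∣Ru∣≡∣Ry∣) ⟩
      ∣ ∁ (K u) ∣ + ∣ R u ∣   ∎)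

  ∣R∣≡m : ∀ {u w} → Balanced u → Side u w → ∣ R w ∣ ≡ m
  ∣R∣≡m {u} {w} ∣Ku∣≡1+h side = proj₂ (side-sizes {u} {w} ∣Ku∣≡1+h side)

  K∧R⇒≡ : ∀ {w w′} → K w ≡ K w′ → R w ≡ R w′ → proj₁ w ≡ proj₁ w′
  K∧R⇒≡ {w} {w′} Kw≡Kw′ Rw≡Rw′ = trans (sym (K++R w)) (trans (cong₂ _++_ Kw≡Kw′ Rw≡Rw′) (K++R w′))

  edge⇐ : ∀ {w w′} → K w′ ≡ ∁ (K w) → Disjoint (R w) (R w′) → Edge w w′
  edge⇐ {w} {w′} = edgeˢ⇐ (proj₁ w) (proj₁ w′)

  m≢1+m : ∀ {x} → x ≡ m → x ≢ suc m
  m≢1+m x≡m x≡1+m = 1+n≢n (trans (sym x≡1+m) x≡m)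

  module ComponentIso (u : Vertex) (∣Ku∣≡1+h : Balanced u) where

    toB : ∀ w → Side u w → BVert (suc m)
    toB w side@(inj₁ _) = R w , inj₁ (∣R∣≡m {u} {w} ∣Ku∣≡1+h side)
    toB w side@(inj₂ _) = ∁ (R w) , inj₂ (∣∁A∣≡1+m (R w) (∣R∣≡m {u} {w} ∣Ku∣≡1+h side))

    toB-irrelevant : ∀ w (side side′ : Side u w) → proj₁ (toB w side) ≡ proj₁ (toB w side′)
    toB-irrelevant w (inj₁ _) (inj₁ _) = refl
    toB-irrelevant w (inj₂ _) (inj₂ _) = refl
    toB-irrelevant w (inj₁ same) (inj₂ opposite) = ⊥-elim (¬same×opposite {u} {w} same opposite)
    toB-irrelevant w (inj₂ opposite) (inj₁ same) = ⊥-elim (¬same×opposite {u} {w} same opposite)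

    toB-injective : ∀ w w′ side side′ → proj₁ (toB w side) ≡ proj₁ (toB w′ side′) → proj₁ w ≡ proj₁ w′
    toB-injective w w′ (inj₁ same) (inj₁ same′) Rw≡Rw′ = K∧R⇒≡ {w} {w′} (trans same (sym same′)) Rw≡Rw′
    toB-injective w w′ (inj₂ opposite) (inj₂ opposite′) ∁Rw≡∁Rw′ =
      K∧R⇒≡ {w} {w′} (trans opposite (sym opposite′)) (∁-injective ∁Rw≡∁Rw′)
    toB-injective w w′ side@(inj₁ _) side′@(inj₂ _) eq =
      ⊥-elim (m≢1+m (∣R∣≡m {u} {w} ∣Ku∣≡1+h side) (trans (cong ∣_∣ eq) (∣∁A∣≡1+m (R w′) (∣R∣≡m {u} {w′} ∣Ku∣≡1+h side′))))
    toB-injective w w′ side@(inj₂ _) side′@(inj₁ _) eq =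
      ⊥-elim (m≢1+m (∣R∣≡m {u} {w′} ∣Ku∣≡1+h side′) (trans (cong ∣_∣ (sym eq)) (∣∁A∣≡1+m (R w) (∣R∣≡m {u} {w} ∣Ku∣≡1+h side))))

    toB-edge : ∀ w w′ side side′ → Edge w w′ → BAdj (suc m) (toB w side) (toB w′ side′)
    toB-edge w w′ side side′ w~w′ with edge⇒ {w} {w′} w~w′
    toB-edge w w′ (inj₁ same) (inj₁ same′) _ | Kw′≡∁Kw , _ =
      ⊥-elim (p≢∁p (K u) (trans (sym same′) (trans Kw′≡∁Kw (cong ∁ same))))
    toB-edge w w′ (inj₂ opposite) (inj₂ opposite′) _ | Kw′≡∁Kw , _ =
      ⊥-elim (p≢∁p (K w) (trans (trans opposite (sym opposite′)) Kw′≡∁Kw))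
    toB-edge w w′ side@(inj₁ _) side′@(inj₂ _) _ | _ , disjoint =
      inj₁ (∣R∣≡m {u} {w} ∣Ku∣≡1+h side , ∣∁A∣≡1+m (R w′) (∣R∣≡m {u} {w′} ∣Ku∣≡1+h side′) ,
            ⊆ᵇ⇒⊆ (Disjoint⇒⊆ᵇ∁ (R w) (R w′) disjoint))
    toB-edge w w′ side@(inj₂ _) side′@(inj₁ _) _ | _ , disjoint =
      inj₂ (∣R∣≡m {u} {w′} ∣Ku∣≡1+h side′ , ∣∁A∣≡1+m (R w) (∣R∣≡m {u} {w} ∣Ku∣≡1+h side) ,
            ⊆ᵇ⇒⊆ (Disjoint⇒⊆ᵇ∁ (R w′) (R w) (Disjoint-sym (R w) (R w′) disjoint)))

    toB-edge⁻ : ∀ w w′ side side′ → BAdj (suc m) (toB w side) (toB w′ side′) → Edge w w′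
    toB-edge⁻ w w′ side@(inj₁ _) side′@(inj₁ _) (inj₁ (_ , ∣Rw′∣≡1+m , _)) = ⊥-elim (m≢1+m (∣R∣≡m {u} {w′} ∣Ku∣≡1+h side′) ∣Rw′∣≡1+m)
    toB-edge⁻ w w′ side@(inj₁ _) side′@(inj₁ _) (inj₂ (_ , ∣Rw∣≡1+m , _)) = ⊥-elim (m≢1+m (∣R∣≡m {u} {w} ∣Ku∣≡1+h side) ∣Rw∣≡1+m)
    toB-edge⁻ w w′ side@(inj₂ _) side′@(inj₂ _) (inj₁ (∣∁Rw∣≡m , _ , _)) =
      ⊥-elim (m≢1+m ∣∁Rw∣≡m (∣∁A∣≡1+m (R w) (∣R∣≡m {u} {w} ∣Ku∣≡1+h side)))
    toB-edge⁻ w w′ side@(inj₂ _) side′@(inj₂ _) (inj₂ (∣∁Rw′∣≡m , _ , _)) =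
      ⊥-elim (m≢1+m ∣∁Rw′∣≡m (∣∁A∣≡1+m (R w′) (∣R∣≡m {u} {w′} ∣Ku∣≡1+h side′)))
    toB-edge⁻ w w′ side@(inj₁ _) side′@(inj₂ _) (inj₂ (∣∁Rw′∣≡m , _ , _)) =
      ⊥-elim (m≢1+m ∣∁Rw′∣≡m (∣∁A∣≡1+m (R w′) (∣R∣≡m {u} {w′} ∣Ku∣≡1+h side′)))
    toB-edge⁻ w w′ side@(inj₂ _) side′@(inj₁ _) (inj₁ (∣∁Rw∣≡m , _ , _)) =
      ⊥-elim (m≢1+m ∣∁Rw∣≡m (∣∁A∣≡1+m (R w) (∣R∣≡m {u} {w} ∣Ku∣≡1+h side)))
    toB-edge⁻ w w′ (inj₁ same) (inj₂ opposite′) (inj₁ (_ , _ , Rw⊆∁Rw′)) =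
      edge⇐ {w} {w′} (trans opposite′ (cong ∁ (sym same))) (⊆ᵇ∁⇒Disjoint (R w) (R w′) (⊆⇒⊆ᵇ Rw⊆∁Rw′))
    toB-edge⁻ w w′ (inj₂ opposite) (inj₁ same′) (inj₂ (_ , _ , Rw′⊆∁Rw)) =
      edge⇐ {w} {w′} (trans same′ (trans (sym (∁-involutive (K u))) (cong ∁ (sym opposite))))
        (Disjoint-sym (R w′) (R w) (⊆ᵇ∁⇒Disjoint (R w′) (R w) (⊆⇒⊆ᵇ Rw′⊆∁Rw)))

    toB-surjective : ∀ (T : BVert (suc m)) → Σ Vertex λ w → Σ (Side u w) λ side → proj₁ (toB w side) ≡ proj₁ T
    toB-surjective (T , inj₁ ∣T∣≡m) =
      balancedVertex (K u) ∣Ku∣≡1+h T ∣T∣≡m , inj₁ (take-++ (K u) T) , drop-++ (K u) T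
    toB-surjective (T , inj₂ ∣T∣≡1+m) =
      balancedVertex (∁ (K u)) (∣∁P∣≡1+h (K u) ∣Ku∣≡1+h) (∁ T) (∣∁A∣≡m T ∣T∣≡1+m) ,
      inj₂ (take-++ (∁ (K u)) (∁ T)) ,
      trans (cong ∁ (drop-++ (∁ (K u)) (∁ T))) (∁-involutive T)

    side : (x : V (ComponentGraph u)) → Side u (proj₁ x)
    side x = connected⇒side (proj₂ x)

    component≅B : ComponentGraph u ≅ B (suc m)
    component≅B = record
      { to      = λ x → toB (proj₁ x) (side x)
      ; to-cong = λ {x} {y} x≈y → to-cong x y x≈y
      ; to-inj  = λ {x} {y} → toB-injective (proj₁ x) (proj₁ y) (side x) (side y)
      ; to-surj = to-surj
      ; adj⇒    = λ {x} {y} → toB-edge (proj₁ x) (proj₁ y) (side x) (side y)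
      ; adj⇐    = λ {x} {y} → toB-edge⁻ (proj₁ x) (proj₁ y) (side x) (side y)
      }
      where
      to-cong : ∀ x y → proj₁ (proj₁ x) ≡ proj₁ (proj₁ y) → proj₁ (toB (proj₁ x) (side x)) ≡ proj₁ (toB (proj₁ y) (side y))
      to-cong (w , u⋯w) (w′ , u⋯w′) eq with Vertex-≡ {w} {w′} eq
      ... | refl = toB-irrelevant w (connected⇒side u⋯w) (connected⇒side u⋯w′)
      to-surj : ∀ T → Σ (V (ComponentGraph u)) λ x → proj₁ (toB (proj₁ x) (side x)) ≡ proj₁ T
      to-surj T with toB-surjective T
      ... | w , side-w , eq = (w , side⇒connected {u} {w} ∣Ku∣≡1+h side-w) ,
        trans (toB-irrelevant w (connected⇒side (side⇒connected {u} {w} ∣Ku∣≡1+h side-w)) side-w) eq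

  -- ι j and κ are the indices of the elements j + 1 ∈ [k - 1] and k of the ground set.
  ι : Fin (N (suc h)) → Fin (k + r)
  ι j = inject₁ j ↑ˡ r

  κ : Fin (k + r)
  κ = fromℕ (N (suc h)) ↑ˡ r

  label : Vertex → Subset (N (suc h))
  label w = Aligned (K w)

  label-side : ∀ {u w} → Side u w → label w ≡ label u
  label-side (inj₁ same) = cong Aligned same
  label-side {u} (inj₂ opposite) = trans (cong Aligned opposite) (Aligned-∁ (K u))

  label⇒connected : ∀ {u w} → Balanced u → label w ≡ label u → Connected u w
  label⇒connected {u} {w} ∣Ku∣≡1+h eq = side⇒connected {u} {w} ∣Ku∣≡1+h (Aligned-injective (K u) (K w) eq)

  ∣label∣ : ∀ {u} → Balanced u → ∣ label u ∣ ≡ h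
  ∣label∣ {u} ∣Ku∣≡1+h = ∣Aligned∣ (K u) ∣Ku∣≡1+h (N-suc h)

  swapVertex : Fin (N (suc h)) → Vertex → Vertex
  swapVertex j w = swapSet (ι j) κ (proj₁ w) , trans (∣swapSet∣ (ι j) κ (proj₁ w)) (proj₂ w)

  label-swap : ∀ j w → lookup (K w) (inject₁ j) ≡ not (lookup (K w) (fromℕ (N (suc h)))) →
    label (swapVertex j w) ≡ ∁ (label w) [ j ]≔ false
  label-swap j w differ = trans (cong Aligned (take-swapSet-↑ˡ k (inject₁ j) (fromℕ (N (suc h))) (proj₁ w)))
    (Aligned-swap (K w) j differ)

  label-swap-∉ : ∀ j w → lookup (label w) j ≡ false → label (swapVertex j w) ≡ ∁ (label w) [ j ]≔ false
  label-swap-∉ j w j∉ = label-swap j w (Aligned≡false⇒differ (K w) j j∉)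

  balanced : (x : MVertex) → Balanced (proj₁ x)
  balanced x = isMiddle⇒balanced (proj₁ x) (proj₂ x)

  toO : MVertex → OVert (suc h)
  toO x = label (proj₁ x) , ∣label∣ {proj₁ x} (balanced x)

  toℕι<N : ∀ j → toℕ (ι j) < N (suc h)
  toℕι<N j = subst (_< N (suc h)) (sym (trans (toℕ-↑ˡ (inject₁ j) r) (toℕ-inject₁ j))) (toℕ<n j)

  toℕκ≡N : toℕ κ ≡ N (suc h)
  toℕκ≡N = trans (toℕ-↑ˡ (fromℕ (N (suc h))) r) (toℕ-fromℕ (N (suc h)))

  ι-κ-unique : ∀ {a b} → toℕ a < N (suc h) → toℕ b ≡ N (suc h) → ∃ λ j → a ≡ ι j × b ≡ κ
  ι-κ-unique {a} a<N b≡N = fromℕ< a<N ,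
    toℕ-injective (sym (trans (toℕ-↑ˡ (inject₁ (fromℕ< a<N)) r) (trans (toℕ-inject₁ (fromℕ< a<N)) (toℕ-fromℕ< a<N)))) ,
    toℕ-injective (trans b≡N (sym toℕκ≡N))

  medge⇒ : ∀ x y → MEdge x y → OAdj (suc h) (toO x) (toO y)
  medge⇒ x y (¬x⋯y , a , b , a<N , b≡N , F) with ι-κ-unique {a} {b} a<N b≡N | proj₁ (F (proj₁ y)) ε
  ... | j , refl , refl | w′ , x⋯w′ , swap-w′≡y with lookup (proj₁ w′) (ι j) ≟ᵇ lookup (proj₁ w′) κ
  ...   | yes same = ⊥-elim (¬x⋯y (Connected-≈ʳ x⋯w′ (trans (sym (swapSet-id (ι j) κ (proj₁ w′) same)) swap-w′≡y)))
  ...   | no differ = Disjoint⇒Empty-∩ (label (proj₁ x)) (label (proj₁ y)) disjoint ,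
                      λ eq → ¬x⋯y (label⇒connected {proj₁ x} {proj₁ y} (balanced x) (sym eq))
    where
    K-differ : lookup (K w′) (inject₁ j) ≡ not (lookup (K w′) (fromℕ (N (suc h))))
    K-differ = trans (sym (lookup-take k (proj₁ w′) (inject₁ j)))
      (trans (≢⇒≡not differ) (cong not (lookup-take k (proj₁ w′) (fromℕ (N (suc h))))))
    label-y : label (proj₁ y) ≡ ∁ (label (proj₁ x)) [ j ]≔ false
    label-y = begin
      label (proj₁ y)                       ≡⟨ cong (λ s → Aligned (take k s)) swap-w′≡y ⟨
      label (swapVertex j w′)               ≡⟨ label-swap j w′ K-differ ⟩
      ∁ (label w′) [ j ]≔ false             ≡⟨ cong (λ X → ∁ X [ j ]≔ false) (label-side {proj₁ x} {w′} (connected⇒side x⋯w′)) ⟩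
      ∁ (label (proj₁ x)) [ j ]≔ false      ∎
      where open ≡-Reasoning
    disjoint : Disjoint (label (proj₁ x)) (label (proj₁ y))
    disjoint = subst (Disjoint (label (proj₁ x))) (sym label-y) (Disjoint-∁-remove (label (proj₁ x)) j)

  swap-into : ∀ (x y : MVertex) j → lookup (label (proj₁ y)) j ≡ false →
    label (proj₁ x) ≡ ∁ (label (proj₁ y)) [ j ]≔ false →
    ∀ w → Connected (proj₁ y) w → Connected (proj₁ x) (swapVertex j w)
  swap-into x y j j∉ly lx≡ w y⋯w = label⇒connected {proj₁ x} {swapVertex j w} (balanced x) (begin
    label (swapVertex j w)              ≡⟨ label-swap-∉ j w (trans (cong (λ X → lookup X j) label-w) j∉ly) ⟩
    ∁ (label w) [ j ]≔ false            ≡⟨ cong (λ X → ∁ X [ j ]≔ false) label-w ⟩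
    ∁ (label (proj₁ y)) [ j ]≔ false    ≡⟨ lx≡ ⟨
    label (proj₁ x)                     ∎)
    where
    open ≡-Reasoning
    label-w : label w ≡ label (proj₁ y)
    label-w = label-side {proj₁ y} {w} (connected⇒side y⋯w)

  medge⇐ : ∀ x y → OAdj (suc h) (toO x) (toO y) → MEdge x y
  medge⇐ x y (empty , lx≢ly) with commonHole⊎Covering lx ly
    where
    lx = label (proj₁ x)
    ly = label (proj₁ y)
  ... | inj₂ cover = ⊥-elim (1+n≢n (begin
    suc (h + h)                                 ≡⟨ N-suc h ⟨
    N (suc h)                                   ≡⟨ ∣p∣+∣q∣≡n (label (proj₁ x)) (label (proj₁ y)) disjoint cover ⟨
    ∣ label (proj₁ x) ∣ + ∣ label (proj₁ y) ∣   ≡⟨ cong₂ _+_ (proj₂ (toO x)) (proj₂ (toO y)) ⟩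
    h + h                                       ∎))
    where
    open ≡-Reasoning
    disjoint = Empty-∩⇒Disjoint (label (proj₁ x)) (label (proj₁ y)) empty
  ... | inj₁ (j , j∉lx , j∉ly) = ¬x⋯y , ι j , κ , toℕι<N j , toℕκ≡N , λ w →
    (λ y⋯w → swapVertex j w , swap-into x y j j∉ly lx≡ w y⋯w , swapSet-involutive (ι j) κ (proj₁ w)) ,
    (λ { (w′ , x⋯w′ , swap-w′≡w) → Connected-≈ʳ (swap-into y x j j∉lx ly≡ w′ x⋯w′) swap-w′≡w })
    where
    lx = label (proj₁ x)
    ly = label (proj₁ y)
    disjoint : Disjoint lx ly
    disjoint = Empty-∩⇒Disjoint lx ly empty
    N≡1+∣lx∣+∣ly∣ : N (suc h) ≡ suc (∣ lx ∣ + ∣ ly ∣)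
    N≡1+∣lx∣+∣ly∣ = trans (N-suc h) (cong suc (sym (cong₂ _+_ (proj₂ (toO x)) (proj₂ (toO y)))))
    lx≡ : lx ≡ ∁ ly [ j ]≔ false
    lx≡ = Disjoint⇒≡∁-remove lx ly j disjoint N≡1+∣lx∣+∣ly∣ j∉lx j∉ly
    ly≡ : ly ≡ ∁ lx [ j ]≔ false
    ly≡ = Disjoint⇒≡∁-remove ly lx j (Disjoint-sym lx ly disjoint)
      (trans N≡1+∣lx∣+∣ly∣ (cong suc (+-comm ∣ lx ∣ ∣ ly ∣))) j∉ly j∉lx
    ¬x⋯y : ¬ Connected (proj₁ x) (proj₁ y)
    ¬x⋯y x⋯y = lx≢ly (sym (label-side {proj₁ x} {proj₁ y} (connected⇒side x⋯y)))

  𝓜≅O : 𝓜 ≅ O (suc h)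
  𝓜≅O = record
    { to      = toO
    ; to-cong = λ {x} {y} x⋯y → sym (label-side {proj₁ x} {proj₁ y} (connected⇒side x⋯y))
    ; to-inj  = λ {x} {y} eq → label⇒connected {proj₁ x} {proj₁ y} (balanced x) (sym eq)
    ; to-surj = to-surj
    ; adj⇒    = λ {x} {y} → medge⇒ x y
    ; adj⇐    = λ {x} {y} → medge⇐ x y
    }
    where
    to-surj : ∀ (X : OVert (suc h)) → Σ MVertex λ x → label (proj₁ x) ≡ proj₁ X
    to-surj (X , ∣X∣≡h) = (u , suc m , s≤s z≤n , ComponentIso.component≅B u ∣Ku∣≡1+h) , label-u
      where
      P = X ∷ʳ true
      ∣P∣≡1+h : ∣ P ∣ ≡ suc h
      ∣P∣≡1+h = trans (∣∷ʳ-true∣ X) (cong suc ∣X∣≡h)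
      rest = ∃-subset-of-size r m (subst (m ≤_) (sym (N-suc m)) (m≤n⇒m≤1+n (m≤m+n m m)))
      u = balancedVertex P ∣P∣≡1+h (proj₁ rest) (proj₂ rest)
      ∣Ku∣≡1+h : Balanced u
      ∣Ku∣≡1+h = trans (cong ∣_∣ (take-++ P (proj₁ rest))) ∣P∣≡1+h
      label-u : label u ≡ X
      label-u = trans (cong Aligned (take-++ P (proj₁ rest))) (Aligned-∷ʳ-true X)

𝓜-cong : ∀ {L L′ s s′ k k′} → L ≡ L′ → s ≡ s′ → k ≡ k′ → Restricted.𝓜 L s k ≡ Restricted.𝓜 L′ s′ k′
𝓜-cong refl refl refl = refl

M≅O : ∀ h m → M (2 + (h + m)) (suc h + suc h) ≅ O (suc h)
M≅O h m = subst (_≅ O (suc h)) (𝓜-cong L≡ s≡ k≡) (Split.𝓜≅O h m)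
  where
  L≡ : Split.k h m + Split.r h m ≡ N (2 + (h + m))
  L≡ = trans (cong₂ (λ x y → suc x + y) (N-suc h) (N-suc m)) (trans (rearrange h m) (sym (N-suc (suc (h + m)))))
    where
    rearrange : ∀ h m → suc (suc (h + h)) + suc (m + m) ≡ suc (suc (h + m) + suc (h + m))
    rearrange = solve-∀
  s≡ : h + suc m ≡ suc (h + m)
  s≡ = +-suc h m
  k≡ : Split.k h m ≡ suc h + suc h
  k≡ = Split.k≡1+h+1+h h m

n*2≡n+n : ∀ n → n * 2 ≡ n + n
n*2≡n+n = solve-∀

decompose : ∀ n k → 2 ≤ n → 2 ∣ k → 2 ≤ k → k ≤ 2 * n ∸ 2 → ∃₂ λ h m → n ≡ 2 + (h + m) × k ≡ suc h + suc h
decompose n k _ (divides zero k≡0) 2≤k _ = ⊥-elim (<⇒≱ (subst (1 <_) k≡0 2≤k) z≤n)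
decompose (suc zero) k (s≤s ()) _ _ _
decompose (suc (suc n₂)) k _ (divides (suc h) k≡2+2h) _ k≤2n-2 = h , n₂ ∸ h , cong (2 +_) (sym (m+[n∸m]≡n h≤n₂)) , k≡
  where
  k≡ : k ≡ suc h + suc h
  k≡ = trans k≡2+2h (n*2≡n+n (suc h))
  2n-2≡ : 2 * (2 + n₂) ∸ 2 ≡ suc n₂ + suc n₂
  2n-2≡ = cong (_∸ 2) (expand n₂)
    where
    expand : ∀ n → 2 * (2 + n) ≡ 2 + (suc n + suc n)
    expand = solve-∀
  h≤n₂ : h ≤ n₂
  h≤n₂ = ≮⇒≥ λ n₂<h → <⇒≱ (+-mono-< (s≤s n₂<h) (s≤s n₂<h)) (subst₂ _≤_ k≡ 2n-2≡ k≤2n-2)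

mainTheorem10 : ∀ (n k : ℕ) → 2 ≤ n → 2 ∣ k → 2 ≤ k → k ≤ 2 * n ∸ 2 →
    M n k ≅ O (k / 2)
mainTheorem10 n k 2≤n 2∣k 2≤k k≤2n-2 with decompose n k 2≤n 2∣k 2≤k k≤2n-2
... | h , m , refl , refl = subst (λ t → M (2 + (h + m)) (suc h + suc h) ≅ O t) (sym half) (M≅O h m)
  where
  half : (suc h + suc h) / 2 ≡ suc h
  half = trans (cong (_/ 2) (sym (n*2≡n+n (suc h)))) (m*n/n≡m (suc h) 2)
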